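{- For every positive integer $k$, $$\mathrm{SgnAltrun}_{4k}(p,q)=\mathrm{SgnAltrun}_{4k+1}(p,q)=2(1-p)(1-q)(1-pq)^{2(k-1)},$$ and $$\mathrm{SgnAltrun}_{4k+2}(p,q)=\mathrm{SgnAltrun}_{4k+3}(p,q)=0.$$
   Context: Let $\mathfrak{S}_n$ be the symmetric group on $[n]=\{1,\dots,n\}$, with permutations written in one-line notation $\pi=\pi_1\pi_2\cdots\pi_n$. Let $\mathrm{inv}(\pi)=|\{1\le i<j\le n:\pi_i>\pi_j\}|$. A peak of $\pi$ is an index $2\le i\le n-1$ with $\pi_{i-1}<\pi_i>\pi_{i+1}$, and a valley is an index $2\le i\le n-1$ with $\pi_{i-1}>\pi_i<\pi_{i+1}$; $\mathrm{pk}(\pi)$ and $\mathrm{val}(\pi)$ denote the numbers of peaks and valleys. Define $\mathrm{SgnAltrun}_n(p,q)=\sum_{\pi\in\mathfrak{S}_n}(-1)^{\mathrm{inv}(\pi)}p^{\mathrm{pk}(\pi)}q^{\mathrm{val}(\pi)}$. -}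

module Defs where

open import Data.Nat as ℕ using (ℕ; zero; suc; _<ᵇ_)
open import Data.Bool using (Bool; true; false; if_then_else_; _∧_)
open import Data.Fin using (Fin; toℕ)
open import Data.Fin.Properties using (_≟_)
open import Data.Vec using (Vec; []; _∷_; toList)
open import Data.List using (List; []; _∷_; map; concatMap; filter; foldr)
open import Data.Integer using (ℤ; +_; -_; _*_; _+_; _^_)
import Data.List.Relation.Unary.Unique.DecPropositional as UD

allFins : (n : ℕ) → List (Fin n)
allFins n = Data.List.allFin n

allVecs : (n m : ℕ) → List (Vec (Fin n) m)
allVecs n zero = [] ∷ []
allVecs n (suc m) = concatMap (λ x → map (x ∷_) (allVecs n m)) (allFins n)

-- The symmetric group S_n, as the list of all permutations of {0,…,n-1}
-- in one-line notation: length-n words over Fin n with pairwise distinct entries.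
perms : (n : ℕ) → List (Vec (Fin n) n)
perms n = filter (λ v → UD.unique? (_≟_ {n}) (toList v)) (allVecs n n)

countLess : ℕ → List ℕ → ℕ
countLess x [] = 0
countLess x (y ∷ ys) = (if y <ᵇ x then 1 else 0) ℕ.+ countLess x ys

inv : List ℕ → ℕ
inv [] = 0
inv (x ∷ xs) = countLess x xs ℕ.+ inv xs

pk : List ℕ → ℕ
pk (a ∷ b ∷ c ∷ rest) = (if (a <ᵇ b) ∧ (c <ᵇ b) then 1 else 0) ℕ.+ pk (b ∷ c ∷ rest)
pk _ = 0

val : List ℕ → ℕ
val (a ∷ b ∷ c ∷ rest) = (if (b <ᵇ a) ∧ (b <ᵇ c) then 1 else 0) ℕ.+ val (b ∷ c ∷ rest)
val _ = 0

oneLine : {n : ℕ} → Vec (Fin n) n → List ℕ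
oneLine v = map toℕ (toList v)

sumℤ : List ℤ → ℤ
sumℤ = foldr _+_ (+ 0)

SgnAltrun : ℕ → ℤ → ℤ → ℤ
SgnAltrun n p q =
  sumℤ (map (λ v → let w = oneLine v in
                   ((- (+ 1)) ^ inv w) * (p ^ pk w) * (q ^ val w))
            (perms n))

-- Weight each permutation further by a or b according as it starts with an ascent or a descent, and
-- by c or d according as it ends with an ascent or a descent; call the resulting sum Φ_n(a, b, c, d).
-- On permutations of {0, …, m + 1}, swapping the two largest letters m and m + 1 reverses the sign
-- and, unless these letters are adjacent at the very beginning or the very end, preserves peaks,
-- valleys and both end steps, so all such permutations cancel. Deleting the adjacent pair from either
-- end of the remaining ones gives, for m ≥ 2,
--   Φ_{m+2}(a, b, c, d) = (p a − b) Φ_m(q, 1, c, d) + (c − p d) Φ_m(a, b, 1, q).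
-- As Φ_2 = Φ_3 = a c − b d, applying the recurrence twice just multiplies by (1 − p q)², and at
-- a = b = c = d = 1 the value a c − b d vanishes while the value after one step is 2 (1 − p) (1 − q).

module Submission where

open import Defs
open import Data.Bool using (Bool; true; false; if_then_else_; _∧_; _∨_; not; T)
open import Data.Bool.Properties using (∧-zeroʳ; ∧-identityʳ; ∧-comm; T-≡)
open import Data.Empty using (⊥-elim)
open import Data.Fin as Fin using (Fin; toℕ)
import Data.Fin.Properties as Finₚ
open import Data.Integer using (ℤ; +_; -_; _*_; _+_; _-_; _^_; -1ℤ)
import Data.Integer.Properties as ℤₚ
import Data.Integer.Tactic.RingSolver as ℤ-Solver
open import Data.List using (List; []; _∷_; map; filterᵇ; _++_; length)
import Data.List.Properties as Listₚ
open import Data.List.Membership.Propositional using (_∈_; _∉_)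
open import Data.List.Membership.Propositional.Properties
open import Data.List.Membership.Propositional.Properties.WithK using (unique∧set⇒bag)
open import Data.List.Relation.Binary.BagAndSetEquality using (∼bag⇒↭)
open import Data.List.Relation.Binary.Disjoint.Propositional using (Disjoint)
open import Data.List.Relation.Binary.Permutation.Propositional as ↭ using (_↭_)
open import Data.List.Relation.Unary.All as All using (All; []; _∷_)
import Data.List.Relation.Unary.All.Properties as Allₚ
open import Data.List.Relation.Unary.AllPairs as AllPairs using ([]; _∷_)
import Data.List.Relation.Unary.AllPairs.Properties as AllPairsₚ
open import Data.List.Relation.Unary.Any as Any using (here; there)
open import Data.List.Relation.Unary.Unique.Propositional using (Unique)
import Data.List.Relation.Unary.Unique.Propositional.Properties as Uniqueₚ
import Data.List.Relation.Unary.Unique.DecPropositional as UniqueDec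
open import Data.Nat using (ℕ; zero; suc; _<ᵇ_; _≡ᵇ_; _<_; _≤_; _∸_; z≤n; s≤s)
import Data.Nat as ℕ
import Data.Nat.Properties as ℕₚ
open import Data.List.Membership.DecPropositional ℕ._≟_ using (_∈?_)
import Data.Nat.Tactic.RingSolver as ℕ-Solver
open import Data.Product using (_×_; _,_; proj₁; proj₂; Σ; map₂)
open import Data.Sum using (_⊎_; inj₁; inj₂)
open import Data.Unit using (tt)
open import Data.Vec using (Vec; []; _∷_; toList)
import Data.Vec.Properties as Vecₚ
open import Function using (_∘_)
open import Function.Bundles using (mk⇔; Equivalence)
open import Relation.Binary.Definitions using (tri<; tri≈; tri>)
open import Relation.Binary.PropositionalEquality
open import Relation.Nullary using (yes; no)
open import Relation.Nullary.Decidable using (T?)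

Σℤ : {A : Set} → (A → ℤ) → List A → ℤ
Σℤ f xs = sumℤ (map f xs)

Σℤ-↭ : {A : Set} (f : A → ℤ) {xs ys : List A} → xs ↭ ys → Σℤ f xs ≡ Σℤ f ys
Σℤ-↭ f ↭.refl = refl
Σℤ-↭ f (↭.prep x p) = cong (_+_ (f x)) (Σℤ-↭ f p)
Σℤ-↭ f (↭.swap x y p) = begin
  f x + (f y + _) ≡⟨ ℤₚ.+-assoc (f x) (f y) _ ⟨
  f x + f y + _   ≡⟨ cong₂ _+_ (ℤₚ.+-comm (f x) (f y)) (Σℤ-↭ f p) ⟩
  f y + f x + _   ≡⟨ ℤₚ.+-assoc (f y) (f x) _ ⟩
  f y + (f x + _) ∎
  where open ≡-Reasoning
Σℤ-↭ f (↭.trans p q) = trans (Σℤ-↭ f p) (Σℤ-↭ f q)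

Σℤ-sameElements : {A : Set} (f : A → ℤ) {xs ys : List A} → Unique xs → Unique ys →
  (∀ {z} → z ∈ xs → z ∈ ys) → (∀ {z} → z ∈ ys → z ∈ xs) → Σℤ f xs ≡ Σℤ f ys
Σℤ-sameElements f uxs uys to from = Σℤ-↭ f (∼bag⇒↭ (unique∧set⇒bag uxs uys (mk⇔ to from)))

Σℤ-cong : {A : Set} {f g : A → ℤ} (xs : List A) → (∀ {x} → x ∈ xs → f x ≡ g x) → Σℤ f xs ≡ Σℤ g xs
Σℤ-cong [] f≗g = refl
Σℤ-cong (x ∷ xs) f≗g = cong₂ _+_ (f≗g (here refl)) (Σℤ-cong xs (f≗g ∘ there))

Σℤ-map : {A B : Set} (f : B → ℤ) (g : A → B) (xs : List A) → Σℤ f (map g xs) ≡ Σℤ (f ∘ g) xs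
Σℤ-map f g [] = refl
Σℤ-map f g (x ∷ xs) = cong (_+_ (f (g x))) (Σℤ-map f g xs)

Σℤ-++ : {A : Set} (f : A → ℤ) (xs ys : List A) → Σℤ f (xs ++ ys) ≡ Σℤ f xs + Σℤ f ys
Σℤ-++ f [] ys = sym (ℤₚ.+-identityˡ _)
Σℤ-++ f (x ∷ xs) ys = trans (cong (_+_ (f x)) (Σℤ-++ f xs ys)) (sym (ℤₚ.+-assoc (f x) _ _))

Σℤ-*ˡ : {A : Set} (k : ℤ) (f : A → ℤ) (xs : List A) → Σℤ (λ x → k * f x) xs ≡ k * Σℤ f xs
Σℤ-*ˡ k f [] = sym (ℤₚ.*-zeroʳ k)
Σℤ-*ˡ k f (x ∷ xs) = trans (cong (_+_ (k * f x)) (Σℤ-*ˡ k f xs)) (sym (ℤₚ.*-distribˡ-+ k (f x) _))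

Σℤ-neg : {A : Set} (f : A → ℤ) (xs : List A) → Σℤ (λ x → - f x) xs ≡ - Σℤ f xs
Σℤ-neg f [] = refl
Σℤ-neg f (x ∷ xs) = trans (cong (_+_ (- f x)) (Σℤ-neg f xs)) (sym (ℤₚ.neg-distrib-+ (f x) _))

Σℤ-partition : {A : Set} (f : A → ℤ) (P : A → Bool) (xs : List A) →
  Σℤ f xs ≡ Σℤ f (filterᵇ P xs) + Σℤ f (filterᵇ (not ∘ P) xs)
Σℤ-partition f P [] = refl
Σℤ-partition f P (x ∷ xs) with P x
... | true = trans (cong (_+_ (f x)) (Σℤ-partition f P xs)) (sym (ℤₚ.+-assoc (f x) _ _))
... | false = trans (cong (_+_ (f x)) (Σℤ-partition f P xs)) (begin
  f x + (A + B) ≡⟨ ℤₚ.+-assoc (f x) A B ⟨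
  f x + A + B   ≡⟨ cong (_+ B) (ℤₚ.+-comm (f x) A) ⟩
  A + f x + B   ≡⟨ ℤₚ.+-assoc A (f x) B ⟩
  A + (f x + B) ∎)
  where open ≡-Reasoning
        A = Σℤ f (filterᵇ P xs)
        B = Σℤ f (filterᵇ (not ∘ P) xs)

x≡-x⇒x≡0 : ∀ x → x ≡ - x → x ≡ + 0
x≡-x⇒x≡0 (+ zero) _ = refl
x≡-x⇒x≡0 (+ suc n) ()
x≡-x⇒x≡0 (ℤ.negsuc n) ()

∈-filterᵇ⁺ : {A : Set} (P : A → Bool) {x : A} {xs : List A} → x ∈ xs → P x ≡ true → x ∈ filterᵇ P xs
∈-filterᵇ⁺ P x∈ Px = ∈-filter⁺ (T? ∘ P) x∈ (Equivalence.from T-≡ Px)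

∈-filterᵇ⁻ : {A : Set} (P : A → Bool) {x : A} (xs : List A) → x ∈ filterᵇ P xs → x ∈ xs × P x ≡ true
∈-filterᵇ⁻ P xs x∈ = map₂ (Equivalence.to T-≡) (∈-filter⁻ (T? ∘ P) {xs = xs} x∈)

filterᵇ-unique : {A : Set} (P : A → Bool) {xs : List A} → Unique xs → Unique (filterᵇ P xs)
filterᵇ-unique P = Uniqueₚ.filter⁺ (T? ∘ P)

not≡true⇒≡false : ∀ {b} → not b ≡ true → b ≡ false
not≡true⇒≡false {false} _ = refl

permWords : ℕ → List (List ℕ)
permWords n = map oneLine (perms n)

IsPermWord : ℕ → List ℕ → Set
IsPermWord n w = length w ≡ n × All (_< n) w × Unique w

allVecs-unique : ∀ n m → Unique (allVecs n m)
allVecs-unique n zero = [] ∷ []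
allVecs-unique n (suc m) =
  Uniqueₚ.concat⁺ (uniqueBlocks (Data.List.allFin n)) (AllPairsₚ.map⁺ (AllPairs.map disjoint (Uniqueₚ.allFin⁺ n)))
  where
  block : Fin n → List (Vec (Fin n) (suc m))
  block x = map (x ∷_) (allVecs n m)
  uniqueBlocks : ∀ xs → All Unique (map block xs)
  uniqueBlocks [] = []
  uniqueBlocks (x ∷ xs) = Uniqueₚ.map⁺ Vecₚ.∷-injectiveʳ (allVecs-unique n m) ∷ uniqueBlocks xs
  disjoint : ∀ {x y} → x ≢ y → Disjoint (block x) (block y)
  disjoint x≢y (p , q) with ∈-map⁻ _ p | ∈-map⁻ _ q
  ... | _ , _ , refl | _ , _ , eq = x≢y (Vecₚ.∷-injectiveˡ eq)

∈-allVecs : ∀ n m (v : Vec (Fin n) m) → v ∈ allVecs n m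
∈-allVecs n zero [] = here refl
∈-allVecs n (suc m) (x ∷ v) =
  ∈-concatMap⁺ (λ y → map (y ∷_) (allVecs n m)) (Any.map (λ { refl → ∈-map⁺ (x ∷_) (∈-allVecs n m v) }) (∈-allFin x))

oneLine-injective : ∀ {n} {u v : Vec (Fin n) n} → oneLine u ≡ oneLine v → u ≡ v
oneLine-injective eq = toList-injective (Listₚ.map-injective Finₚ.toℕ-injective eq)
  where
  toList-injective : ∀ {A : Set} {m} {u v : Vec A m} → toList u ≡ toList v → u ≡ v
  toList-injective {u = []} {[]} _ = refl
  toList-injective {u = x ∷ u} {y ∷ v} e with Listₚ.∷-injective e
  ... | refl , e′ = cong (x ∷_) (toList-injective e′)

permWords-unique : ∀ n → Unique (permWords n)
permWords-unique n = Uniqueₚ.map⁺ oneLine-injective (Uniqueₚ.filter⁺ _ (allVecs-unique n n))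

∈-permWords⁻ : ∀ {n w} → w ∈ permWords n → IsPermWord n w
∈-permWords⁻ {n} w∈ with ∈-map⁻ oneLine w∈
... | v , v∈ , refl with ∈-filter⁻ (λ v → UniqueDec.unique? (Finₚ._≟_ {n}) (toList v)) {xs = allVecs n n} v∈
... | _ , unique =
  trans (Listₚ.length-map toℕ (toList v)) (Vecₚ.length-toList v) ,
  Allₚ.map⁺ (All.universal Finₚ.toℕ<n (toList v)) ,
  Uniqueₚ.map⁺ Finₚ.toℕ-injective unique

toℕ-surjective-list : ∀ {n} w → All (_< n) w → Σ (Vec (Fin n) (length w)) (λ v → map toℕ (toList v) ≡ w)
toℕ-surjective-list [] [] = [] , refl
toℕ-surjective-list (x ∷ w) (x<n ∷ w<n) with toℕ-surjective-list w w<n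
... | v , e = Fin.fromℕ< x<n ∷ v , cong₂ _∷_ (Finₚ.toℕ-fromℕ< x<n) e

∈-permWords⁺ : ∀ {n w} → IsPermWord n w → w ∈ permWords n
∈-permWords⁺ {w = w} (refl , w<n , unique) with toℕ-surjective-list w w<n
... | v , e = subst (_∈ permWords (length w)) e
  (∈-map⁺ oneLine (∈-filter⁺ (λ v → UniqueDec.unique? (Finₚ._≟_ {length w}) (toList v))
    (∈-allVecs _ _ v) (Uniqueₚ.map⁻ (subst Unique (sym e) unique))))

remove : ℕ → List ℕ → List ℕ
remove k [] = []
remove k (x ∷ xs) = if x ≡ᵇ k then xs else x ∷ remove k xs

length-remove : ∀ k xs → length xs ≤ suc (length (remove k xs))
length-remove k [] = z≤n
length-remove k (x ∷ xs) with x ≡ᵇ k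
... | true = ℕₚ.≤-refl
... | false = s≤s (length-remove k xs)

remove-All : ∀ {P : ℕ → Set} k xs → All P xs → All P (remove k xs)
remove-All k [] [] = []
remove-All k (x ∷ xs) (px ∷ pxs) with x ≡ᵇ k
... | true = pxs
... | false = px ∷ remove-All k xs pxs

remove-unique : ∀ k xs → Unique xs → Unique (remove k xs)
remove-unique k [] u = u
remove-unique k (x ∷ xs) (x∉xs ∷ u) with x ≡ᵇ k
... | true = u
... | false = remove-All k xs x∉xs ∷ remove-unique k xs u

All<suc⇒All< : ∀ {k} xs → All (_< suc k) xs → k ∉ xs → All (_< k) xs
All<suc⇒All< [] [] _ = []
All<suc⇒All< (x ∷ xs) (x<1+k ∷ xs<1+k) k∉ =
  ℕₚ.≤∧≢⇒< (ℕₚ.≤-pred x<1+k) (λ e → k∉ (here (sym e))) ∷ All<suc⇒All< xs xs<1+k (k∉ ∘ there)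

remove-All< : ∀ k xs → Unique xs → All (_< suc k) xs → All (_< k) (remove k xs)
remove-All< k [] _ _ = []
remove-All< k (x ∷ xs) (x∉xs ∷ u) (x<1+k ∷ xs<1+k) with x ≡ᵇ k in e
... | true = All<suc⇒All< xs xs<1+k
               (λ k∈ → All.lookup x∉xs k∈ (ℕₚ.≡ᵇ⇒≡ x k (subst T (sym e) tt)))
... | false = ℕₚ.≤∧≢⇒< (ℕₚ.≤-pred x<1+k) (λ x≡k → subst T e (ℕₚ.≡⇒≡ᵇ x k x≡k))
              ∷ remove-All< k xs u xs<1+k

unique-All<⇒length≤ : ∀ k xs → Unique xs → All (_< k) xs → length xs ≤ k
unique-All<⇒length≤ zero [] _ _ = z≤n
unique-All<⇒length≤ zero (x ∷ xs) _ (() ∷ _)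
unique-All<⇒length≤ (suc k) xs u xs<1+k =
  ℕₚ.≤-trans (length-remove k xs)
    (s≤s (unique-All<⇒length≤ k (remove k xs) (remove-unique k xs u) (remove-All< k xs u xs<1+k)))

largest∈permWord : ∀ {n w} → IsPermWord (suc n) w → n ∈ w
largest∈permWord {n} {w} (len , w<1+n , u) with n ∈? w
... | yes n∈w = n∈w
... | no n∉w = ⊥-elim (ℕₚ.<-irrefl refl
      (subst (_≤ n) len (unique-All<⇒length≤ n w u (All<suc⇒All< w w<1+n n∉w))))

χ : Bool → ℕ
χ b = if b then 1 else 0

<ᵇ-true : ∀ {x y} → x < y → (x <ᵇ y) ≡ true
<ᵇ-true x<y = Equivalence.to T-≡ (ℕₚ.<⇒<ᵇ x<y)

<ᵇ-false : ∀ {x y} → y ≤ x → (x <ᵇ y) ≡ false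
<ᵇ-false {x} {y} y≤x with x <ᵇ y in eq
... | false = refl
... | true = ⊥-elim (ℕₚ.<⇒≱ (ℕₚ.<ᵇ⇒< x y (subst T (sym eq) tt)) y≤x)

≡ᵇ-refl : ∀ x → (x ≡ᵇ x) ≡ true
≡ᵇ-refl x = Equivalence.to T-≡ (ℕₚ.≡⇒≡ᵇ x x refl)

≡ᵇ-false : ∀ {x y} → x ≢ y → (x ≡ᵇ y) ≡ false
≡ᵇ-false {x} {y} x≢y with x ≡ᵇ y in eq
... | false = refl
... | true = ⊥-elim (x≢y (ℕₚ.≡ᵇ⇒≡ x y (subst T (sym eq) tt)))

sign : List ℕ → ℤ
sign w = -1ℤ ^ inv w

startFactor : List ℕ → ℤ → ℤ → ℤ
startFactor (x ∷ y ∷ _) a b = if x <ᵇ y then a else b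
startFactor _ a b = + 1

endFactor : List ℕ → ℤ → ℤ → ℤ
endFactor (x ∷ y ∷ []) c d = if y <ᵇ x then d else c
endFactor (x ∷ y ∷ z ∷ r) c d = endFactor (y ∷ z ∷ r) c d
endFactor _ c d = + 1

weight : ℤ → ℤ → ℤ → ℤ → ℤ → ℤ → List ℕ → ℤ
weight p q a b c d w = sign w * p ^ pk w * q ^ val w * startFactor w a b * endFactor w c d

Φ : ℤ → ℤ → ℤ → ℤ → ℤ → ℤ → ℕ → ℤ
Φ p q a b c d n = Σℤ (weight p q a b c d) (permWords n)

startFactor-1 : ∀ w → startFactor w (+ 1) (+ 1) ≡ + 1
startFactor-1 [] = refl
startFactor-1 (x ∷ []) = refl
startFactor-1 (x ∷ y ∷ w) with x <ᵇ y
... | true = refl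
... | false = refl

endFactor-1 : ∀ w → endFactor w (+ 1) (+ 1) ≡ + 1
endFactor-1 [] = refl
endFactor-1 (x ∷ []) = refl
endFactor-1 (x ∷ y ∷ []) with y <ᵇ x
... | true = refl
... | false = refl
endFactor-1 (x ∷ y ∷ z ∷ w) = endFactor-1 (y ∷ z ∷ w)

SgnAltrun≡Φ : ∀ n p q → SgnAltrun n p q ≡ Φ p q (+ 1) (+ 1) (+ 1) (+ 1) n
SgnAltrun≡Φ n p q = sym (trans (Σℤ-map (weight p q (+ 1) (+ 1) (+ 1) (+ 1)) oneLine (perms n))
  (Σℤ-cong (perms n) (λ {v} _ → weight-1111 (oneLine v))))
  where
  weight-1111 : ∀ w → weight p q (+ 1) (+ 1) (+ 1) (+ 1) w ≡ sign w * p ^ pk w * q ^ val w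
  weight-1111 w rewrite startFactor-1 w | endFactor-1 w = trans (ℤₚ.*-identityʳ _) (ℤₚ.*-identityʳ _)

weight-≡ : ∀ p q a b c d w {i k v s e} → inv w ≡ i → pk w ≡ k → val w ≡ v →
  startFactor w a b ≡ s → endFactor w c d ≡ e → weight p q a b c d w ≡ -1ℤ ^ i * p ^ k * q ^ v * s * e
weight-≡ p q a b c d w refl refl refl refl refl = refl

countLess-All< : ∀ {x ys} → All (_< x) ys → countLess x ys ≡ length ys
countLess-All< [] = refl
countLess-All< (y<x ∷ ys<x) rewrite <ᵇ-true y<x = cong suc (countLess-All< ys<x)

-1ℤ^-even+ : ∀ k j → -1ℤ ^ (k ℕ.+ (k ℕ.+ j)) ≡ -1ℤ ^ j
-1ℤ^-even+ zero j = refl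
-1ℤ^-even+ (suc k) j rewrite ℕₚ.+-suc k (k ℕ.+ j) =
  trans (sym (ℤₚ.*-assoc -1ℤ -1ℤ _)) (trans (ℤₚ.*-identityˡ _) (-1ℤ^-even+ k j))

^-χ+ : ∀ (q : ℤ) b n → q ^ (χ b ℕ.+ n) ≡ (if b then q else + 1) * q ^ n
^-χ+ q true n = refl
^-χ+ q false n = sym (ℤₚ.*-identityˡ _)

-- Removing the two largest letters from either end

-- In this section ↑ stands for the adjacent letters m, 1+m and ↓ for 1+m, m, every other letter being < m.

inv-↑∷ : ∀ m w → All (_< m) w → inv (m ∷ suc m ∷ w) ≡ length w ℕ.+ (length w ℕ.+ inv w)
inv-↑∷ m w w<m rewrite <ᵇ-false {suc m} {m} (ℕₚ.n≤1+n m)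
  | countLess-All< w<m | countLess-All< (All.map ℕₚ.m<n⇒m<1+n w<m) = refl

inv-↓∷ : ∀ m w → All (_< m) w → inv (suc m ∷ m ∷ w) ≡ suc (length w ℕ.+ (length w ℕ.+ inv w))
inv-↓∷ m w w<m rewrite <ᵇ-true {m} {suc m} (ℕₚ.n<1+n m)
  | countLess-All< w<m | countLess-All< (All.map ℕₚ.m<n⇒m<1+n w<m) = refl

pk-↑∷ : ∀ m r₁ r₂ ρ → r₁ < m → pk (m ∷ suc m ∷ r₁ ∷ r₂ ∷ ρ) ≡ suc (pk (r₁ ∷ r₂ ∷ ρ))
pk-↑∷ m r₁ r₂ ρ r₁<m rewrite <ᵇ-true {m} {suc m} (ℕₚ.n<1+n m)
  | <ᵇ-true (ℕₚ.m<n⇒m<1+n r₁<m) | <ᵇ-false {suc m} {r₁} (ℕₚ.<⇒≤ (ℕₚ.m<n⇒m<1+n r₁<m)) = refl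

pk-↓∷ : ∀ m r₁ r₂ ρ → r₁ < m → pk (suc m ∷ m ∷ r₁ ∷ r₂ ∷ ρ) ≡ pk (r₁ ∷ r₂ ∷ ρ)
pk-↓∷ m r₁ r₂ ρ r₁<m rewrite <ᵇ-false {suc m} {m} (ℕₚ.n≤1+n m) | <ᵇ-false {m} {r₁} (ℕₚ.<⇒≤ r₁<m) = refl

val-↑∷ : ∀ m r₁ r₂ ρ → r₁ < m → val (m ∷ suc m ∷ r₁ ∷ r₂ ∷ ρ) ≡ χ (r₁ <ᵇ r₂) ℕ.+ val (r₁ ∷ r₂ ∷ ρ)
val-↑∷ m r₁ r₂ ρ r₁<m rewrite <ᵇ-false {suc m} {m} (ℕₚ.n≤1+n m) | <ᵇ-true (ℕₚ.m<n⇒m<1+n r₁<m) = refl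

val-↓∷ : ∀ m r₁ r₂ ρ → r₁ < m → val (suc m ∷ m ∷ r₁ ∷ r₂ ∷ ρ) ≡ χ (r₁ <ᵇ r₂) ℕ.+ val (r₁ ∷ r₂ ∷ ρ)
val-↓∷ m r₁ r₂ ρ r₁<m rewrite <ᵇ-true {m} {suc m} (ℕₚ.n<1+n m)
  | <ᵇ-true r₁<m | <ᵇ-false {m} {r₁} (ℕₚ.<⇒≤ r₁<m) = refl

-- The first letter of the remaining word is a valley exactly when that word starts with an ascent:
-- hence the start weights (a , b) become (q , 1).
weight-↑∷ : ∀ p q a b c d m r₁ r₂ ρ → All (_< m) (r₁ ∷ r₂ ∷ ρ) →
  weight p q a b c d (m ∷ suc m ∷ r₁ ∷ r₂ ∷ ρ) ≡ p * a * weight p q q (+ 1) c d (r₁ ∷ r₂ ∷ ρ)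
weight-↑∷ p q a b c d m r₁ r₂ ρ w<m@(r₁<m ∷ _) = begin
  weight p q a b c d (m ∷ suc m ∷ w)
    ≡⟨ weight-≡ p q a b c d (m ∷ suc m ∷ w) (inv-↑∷ m w w<m) (pk-↑∷ m r₁ r₂ ρ r₁<m)
         (val-↑∷ m r₁ r₂ ρ r₁<m) (cong (λ z → if z then a else b) (<ᵇ-true (ℕₚ.n<1+n m))) refl ⟩
  -1ℤ ^ (ℓ ℕ.+ (ℓ ℕ.+ inv w)) * (p * p ^ pk w) * q ^ (χ (r₁ <ᵇ r₂) ℕ.+ val w) * a * E
    ≡⟨ cong₂ (λ s v → s * (p * p ^ pk w) * v * a * E) (-1ℤ^-even+ ℓ (inv w)) (^-χ+ q (r₁ <ᵇ r₂) (val w)) ⟩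
  sign w * (p * p ^ pk w) * (startFactor w q (+ 1) * q ^ val w) * a * E
    ≡⟨ rearrange p a (sign w) (p ^ pk w) (q ^ val w) (startFactor w q (+ 1)) E ⟩
  p * a * weight p q q (+ 1) c d w ∎
  where
  open ≡-Reasoning
  w = r₁ ∷ r₂ ∷ ρ
  ℓ = length w
  E = endFactor w c d
  rearrange : ∀ p a s P V S E → s * (p * P) * (S * V) * a * E ≡ p * a * (s * P * V * S * E)
  rearrange = ℤ-Solver.solve-∀

weight-↓∷ : ∀ p q a b c d m r₁ r₂ ρ → All (_< m) (r₁ ∷ r₂ ∷ ρ) →
  weight p q a b c d (suc m ∷ m ∷ r₁ ∷ r₂ ∷ ρ) ≡ - b * weight p q q (+ 1) c d (r₁ ∷ r₂ ∷ ρ)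
weight-↓∷ p q a b c d m r₁ r₂ ρ w<m@(r₁<m ∷ _) = begin
  weight p q a b c d (suc m ∷ m ∷ w)
    ≡⟨ weight-≡ p q a b c d (suc m ∷ m ∷ w) (inv-↓∷ m w w<m) (pk-↓∷ m r₁ r₂ ρ r₁<m)
         (val-↓∷ m r₁ r₂ ρ r₁<m) (cong (λ z → if z then a else b) (<ᵇ-false (ℕₚ.n≤1+n m))) refl ⟩
  -1ℤ * -1ℤ ^ (ℓ ℕ.+ (ℓ ℕ.+ inv w)) * p ^ pk w * q ^ (χ (r₁ <ᵇ r₂) ℕ.+ val w) * b * E
    ≡⟨ cong₂ (λ s v → -1ℤ * s * p ^ pk w * v * b * E) (-1ℤ^-even+ ℓ (inv w)) (^-χ+ q (r₁ <ᵇ r₂) (val w)) ⟩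
  -1ℤ * sign w * p ^ pk w * (startFactor w q (+ 1) * q ^ val w) * b * E
    ≡⟨ rearrange b (sign w) (p ^ pk w) (q ^ val w) (startFactor w q (+ 1)) E ⟩
  - b * weight p q q (+ 1) c d w ∎
  where
  open ≡-Reasoning
  w = r₁ ∷ r₂ ∷ ρ
  ℓ = length w
  E = endFactor w c d
  rearrange : ∀ b s P V S E → -1ℤ * s * P * (S * V) * b * E ≡ - b * (s * P * V * S * E)
  rearrange = ℤ-Solver.solve-∀

endsWithDescent : List ℕ → ℕ
endsWithDescent (x ∷ y ∷ []) = χ (y <ᵇ x)
endsWithDescent (x ∷ y ∷ z ∷ r) = endsWithDescent (y ∷ z ∷ r)
endsWithDescent _ = 0

endFactor-1-q : ∀ q w → endFactor w (+ 1) q ≡ q ^ endsWithDescent w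
endFactor-1-q q [] = refl
endFactor-1-q q (x ∷ []) = refl
endFactor-1-q q (x ∷ y ∷ []) with y <ᵇ x
... | true = sym (ℤₚ.*-identityʳ q)
... | false = refl
endFactor-1-q q (x ∷ y ∷ z ∷ r) = endFactor-1-q q (y ∷ z ∷ r)

countLess-++ : ∀ r w x y → r < x → r < y → countLess r (w ++ x ∷ y ∷ []) ≡ countLess r w
countLess-++ r [] x y r<x r<y rewrite <ᵇ-false {x} {r} (ℕₚ.<⇒≤ r<x) | <ᵇ-false {y} {r} (ℕₚ.<⇒≤ r<y) = refl
countLess-++ r (z ∷ w) x y r<x r<y = cong (χ (z <ᵇ r) ℕ.+_) (countLess-++ r w x y r<x r<y)

inv-++ : ∀ w x y → All (_< x) w → All (_< y) w → inv (w ++ x ∷ y ∷ []) ≡ inv w ℕ.+ inv (x ∷ y ∷ [])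
inv-++ [] x y _ _ = refl
inv-++ (r ∷ w) x y (r<x ∷ w<x) (r<y ∷ w<y) rewrite countLess-++ r w x y r<x r<y | inv-++ w x y w<x w<y =
  sym (ℕₚ.+-assoc (countLess r w) (inv w) _)

pk-++ : ∀ r₁ r₂ ρ x y → All (_< x) (r₁ ∷ r₂ ∷ ρ) →
  pk ((r₁ ∷ r₂ ∷ ρ) ++ x ∷ y ∷ []) ≡ pk (r₁ ∷ r₂ ∷ ρ) ℕ.+ χ (y <ᵇ x)
pk-++ r₁ r₂ [] x y (_ ∷ r₂<x ∷ _) rewrite <ᵇ-false {x} {r₂} (ℕₚ.<⇒≤ r₂<x) | ∧-zeroʳ (r₁ <ᵇ r₂)
  | <ᵇ-true r₂<x = ℕₚ.+-identityʳ _
pk-++ r₁ r₂ (r₃ ∷ ρ) x y (_ ∷ w<x) rewrite pk-++ r₂ r₃ ρ x y w<x =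
  sym (ℕₚ.+-assoc (χ ((r₁ <ᵇ r₂) ∧ (r₃ <ᵇ r₂))) _ _)

val-++ : ∀ r₁ r₂ ρ x y → All (_< x) (r₁ ∷ r₂ ∷ ρ) →
  val ((r₁ ∷ r₂ ∷ ρ) ++ x ∷ y ∷ []) ≡ val (r₁ ∷ r₂ ∷ ρ) ℕ.+ endsWithDescent (r₁ ∷ r₂ ∷ ρ)
val-++ r₁ r₂ [] x y (_ ∷ r₂<x ∷ _) rewrite <ᵇ-true r₂<x | ∧-identityʳ (r₂ <ᵇ r₁)
  | <ᵇ-false {x} {r₂} (ℕₚ.<⇒≤ r₂<x) = ℕₚ.+-identityʳ _
val-++ r₁ r₂ (r₃ ∷ ρ) x y (_ ∷ w<x) rewrite val-++ r₂ r₃ ρ x y w<x =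
  sym (ℕₚ.+-assoc (χ ((r₂ <ᵇ r₁) ∧ (r₂ <ᵇ r₃))) _ _)

endFactor-++ : ∀ w x y c d → endFactor (w ++ x ∷ y ∷ []) c d ≡ (if y <ᵇ x then d else c)
endFactor-++ [] x y c d = refl
endFactor-++ (r ∷ []) x y c d = refl
endFactor-++ (r₁ ∷ r₂ ∷ []) x y c d = refl
endFactor-++ (r₁ ∷ r₂ ∷ r₃ ∷ w) x y c d = endFactor-++ (r₂ ∷ r₃ ∷ w) x y c d

-- Symmetrically, the last letter of the remaining word is a valley exactly when that word ends with
-- a descent: hence the end weights (c , d) become (1 , q).
weight-++↑ : ∀ p q a b c d m r₁ r₂ ρ → All (_< m) (r₁ ∷ r₂ ∷ ρ) →
  weight p q a b c d ((r₁ ∷ r₂ ∷ ρ) ++ m ∷ suc m ∷ []) ≡ c * weight p q a b (+ 1) q (r₁ ∷ r₂ ∷ ρ)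
weight-++↑ p q a b c d m r₁ r₂ ρ w<m = begin
  weight p q a b c d (w ++ m ∷ suc m ∷ [])
    ≡⟨ weight-≡ p q a b c d (w ++ m ∷ suc m ∷ [])
         (trans (inv-++ w m (suc m) w<m w<1+m) (n+0 (inv w) inv-↑))
         (trans (pk-++ r₁ r₂ ρ m (suc m) w<m) (n+0 (pk w) (cong χ (<ᵇ-false (ℕₚ.n≤1+n m)))))
         (val-++ r₁ r₂ ρ m (suc m) w<m) refl
         (trans (endFactor-++ w m (suc m) c d) (cong (λ z → if z then d else c) (<ᵇ-false (ℕₚ.n≤1+n m)))) ⟩
  sign w * p ^ pk w * q ^ (val w ℕ.+ endsWithDescent w) * S * c
    ≡⟨ cong (λ v → sign w * p ^ pk w * v * S * c) (ℤₚ.^-distribˡ-+-* q (val w) (endsWithDescent w)) ⟩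
  sign w * p ^ pk w * (q ^ val w * q ^ endsWithDescent w) * S * c
    ≡⟨ rearrange c (sign w) (p ^ pk w) (q ^ val w) (q ^ endsWithDescent w) S ⟩
  c * (sign w * p ^ pk w * q ^ val w * S * q ^ endsWithDescent w)
    ≡⟨ cong (λ e → c * (sign w * p ^ pk w * q ^ val w * S * e)) (endFactor-1-q q w) ⟨
  c * weight p q a b (+ 1) q w ∎
  where
  open ≡-Reasoning
  w = r₁ ∷ r₂ ∷ ρ
  w<1+m = All.map ℕₚ.m<n⇒m<1+n w<m
  S = startFactor w a b
  inv-↑ : inv (m ∷ suc m ∷ []) ≡ 0
  inv-↑ rewrite <ᵇ-false {suc m} {m} (ℕₚ.n≤1+n m) = refl
  n+0 : ∀ {k} n → k ≡ 0 → n ℕ.+ k ≡ n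
  n+0 n refl = ℕₚ.+-identityʳ n
  rearrange : ∀ c s P V D S → s * P * (V * D) * S * c ≡ c * (s * P * V * S * D)
  rearrange = ℤ-Solver.solve-∀

weight-++↓ : ∀ p q a b c d m r₁ r₂ ρ → All (_< m) (r₁ ∷ r₂ ∷ ρ) →
  weight p q a b c d ((r₁ ∷ r₂ ∷ ρ) ++ suc m ∷ m ∷ []) ≡ - (p * d) * weight p q a b (+ 1) q (r₁ ∷ r₂ ∷ ρ)
weight-++↓ p q a b c d m r₁ r₂ ρ w<m = begin
  weight p q a b c d (w ++ suc m ∷ m ∷ [])
    ≡⟨ weight-≡ p q a b c d (w ++ suc m ∷ m ∷ [])
         (trans (inv-++ w (suc m) m w<1+m w<m) (n+1 (inv w) inv-↓))
         (trans (pk-++ r₁ r₂ ρ (suc m) m w<1+m) (n+1 (pk w) (cong χ m<ᵇ1+m)))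
         (val-++ r₁ r₂ ρ (suc m) m w<1+m) refl
         (trans (endFactor-++ w (suc m) m c d) (cong (λ z → if z then d else c) m<ᵇ1+m)) ⟩
  -1ℤ * sign w * (p * p ^ pk w) * q ^ (val w ℕ.+ endsWithDescent w) * S * d
    ≡⟨ cong (λ v → -1ℤ * sign w * (p * p ^ pk w) * v * S * d) (ℤₚ.^-distribˡ-+-* q (val w) (endsWithDescent w)) ⟩
  -1ℤ * sign w * (p * p ^ pk w) * (q ^ val w * q ^ endsWithDescent w) * S * d
    ≡⟨ rearrange p d (sign w) (p ^ pk w) (q ^ val w) (q ^ endsWithDescent w) S ⟩
  - (p * d) * (sign w * p ^ pk w * q ^ val w * S * q ^ endsWithDescent w)
    ≡⟨ cong (λ e → - (p * d) * (sign w * p ^ pk w * q ^ val w * S * e)) (endFactor-1-q q w) ⟨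
  - (p * d) * weight p q a b (+ 1) q w ∎
  where
  open ≡-Reasoning
  w = r₁ ∷ r₂ ∷ ρ
  w<1+m = All.map ℕₚ.m<n⇒m<1+n w<m
  S = startFactor w a b
  m<ᵇ1+m = <ᵇ-true (ℕₚ.n<1+n m)
  inv-↓ : inv (suc m ∷ m ∷ []) ≡ 1
  inv-↓ rewrite m<ᵇ1+m = refl
  n+1 : ∀ {k} n → k ≡ 1 → n ℕ.+ k ≡ suc n
  n+1 n refl = ℕₚ.+-comm n 1
  rearrange : ∀ p d s P V D S → -1ℤ * s * (p * P) * (V * D) * S * d ≡ - (p * d) * (s * P * V * S * D)
  rearrange = ℤ-Solver.solve-∀

-- Swapping the two largest letters

τ : ℕ → ℕ → ℕ
τ m x = if x ≡ᵇ m then suc m else (if x ≡ᵇ suc m then m else x)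

isTop : ℕ → ℕ → Bool
isTop m x = (x ≡ᵇ m) ∨ (x ≡ᵇ suc m)

data TopCases (m x : ℕ) : Set where
  low : x ≢ m → x ≢ suc m → TopCases m x
  is-m : x ≡ m → TopCases m x
  is-1+m : x ≡ suc m → TopCases m x

topCases : ∀ m x → TopCases m x
topCases m x with x ℕ.≟ m | x ℕ.≟ suc m
... | yes x≡m | _ = is-m x≡m
... | no _ | yes x≡1+m = is-1+m x≡1+m
... | no x≢m | no x≢1+m = low x≢m x≢1+m

τ-m : ∀ m → τ m m ≡ suc m
τ-m m rewrite ≡ᵇ-refl m = refl

τ-1+m : ∀ m → τ m (suc m) ≡ m
τ-1+m m rewrite ≡ᵇ-false {suc m} ℕₚ.1+n≢n | ≡ᵇ-refl m = refl

τ-low : ∀ {m x} → x ≢ m → x ≢ suc m → τ m x ≡ x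
τ-low x≢m x≢1+m rewrite ≡ᵇ-false x≢m | ≡ᵇ-false x≢1+m = refl

τ-below : ∀ {m x} → x < m → τ m x ≡ x
τ-below x<m = τ-low (ℕₚ.<⇒≢ x<m) (ℕₚ.<⇒≢ (ℕₚ.m<n⇒m<1+n x<m))

isTop-m : ∀ m → isTop m m ≡ true
isTop-m m rewrite ≡ᵇ-refl m = refl

isTop-1+m : ∀ m → isTop m (suc m) ≡ true
isTop-1+m m rewrite ≡ᵇ-false {suc m} ℕₚ.1+n≢n | ≡ᵇ-refl m = refl

isTop-low : ∀ {m x} → x ≢ m → x ≢ suc m → isTop m x ≡ false
isTop-low x≢m x≢1+m rewrite ≡ᵇ-false x≢m | ≡ᵇ-false x≢1+m = refl

τ-involutive : ∀ m x → τ m (τ m x) ≡ x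
τ-involutive m x with topCases m x
... | is-m refl rewrite τ-m m = τ-1+m m
... | is-1+m refl rewrite τ-1+m m = τ-m m
... | low x≢m x≢1+m rewrite τ-low x≢m x≢1+m = τ-low x≢m x≢1+m

τ-injective : ∀ m {x y} → τ m x ≡ τ m y → x ≡ y
τ-injective m {x} {y} e = trans (sym (τ-involutive m x)) (trans (cong (τ m) e) (τ-involutive m y))

map-τ-involutive : ∀ m w → map (τ m) (map (τ m) w) ≡ w
map-τ-involutive m [] = refl
map-τ-involutive m (x ∷ w) = cong₂ _∷_ (τ-involutive m x) (map-τ-involutive m w)

isTop-τ : ∀ m x → isTop m (τ m x) ≡ isTop m x
isTop-τ m x with topCases m x
... | is-m refl rewrite τ-m m | isTop-m m = isTop-1+m m
... | is-1+m refl rewrite τ-1+m m | isTop-1+m m = isTop-m m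
... | low x≢m x≢1+m rewrite τ-low x≢m x≢1+m = refl

low<m : ∀ {m x} → x < suc (suc m) → x ≢ m → x ≢ suc m → x < m
low<m {m} {x} x<2+m x≢m x≢1+m with ℕₚ.<-cmp x m
... | tri< x<m _ _ = x<m
... | tri≈ _ x≡m _ = ⊥-elim (x≢m x≡m)
... | tri> _ _ m<x = ⊥-elim (x≢1+m (ℕₚ.≤-antisym (ℕₚ.≤-pred x<2+m) m<x))

τ-< : ∀ m x → x < suc (suc m) → τ m x < suc (suc m)
τ-< m x x<2+m with topCases m x
... | low x≢m x≢1+m rewrite τ-low x≢m x≢1+m = x<2+m
... | is-m refl rewrite τ-m m = ℕₚ.n<1+n _
... | is-1+m refl rewrite τ-1+m m = ℕₚ.m<n⇒m<1+n (ℕₚ.n<1+n m)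

IsPermWord-τ : ∀ m w → IsPermWord (suc (suc m)) w → IsPermWord (suc (suc m)) (map (τ m) w)
IsPermWord-τ m w (len , w<2+m , unique) =
  trans (Listₚ.length-map (τ m) w) len ,
  Allₚ.map⁺ (All.map (τ-< m _) w<2+m) ,
  Uniqueₚ.map⁺ (τ-injective m) unique

secondLargest∈permWord : ∀ m w → IsPermWord (suc (suc m)) w → m ∈ w
secondLargest∈permWord m w isPerm with ∈-map⁻ (τ m) (largest∈permWord (IsPermWord-τ m w isPerm))
... | x , x∈w , 1+m≡τx =
  subst (_∈ w) (trans (sym (τ-involutive m x)) (trans (cong (τ m) (sym 1+m≡τx)) (τ-1+m m))) x∈w

true≢false : true ≢ false
true≢false ()

τ-<ᵇ : ∀ m x y → x < suc (suc m) → y < suc (suc m) → (isTop m x ∧ isTop m y) ≡ false →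
  (τ m x <ᵇ τ m y) ≡ (x <ᵇ y)
τ-<ᵇ m x y x<2+m y<2+m notBoth with topCases m x | topCases m y
... | low x≢m x≢1+m | low y≢m y≢1+m rewrite τ-low x≢m x≢1+m | τ-low y≢m y≢1+m = refl
... | low x≢m x≢1+m | is-m refl rewrite τ-low x≢m x≢1+m | τ-m m
      | <ᵇ-true (ℕₚ.m<n⇒m<1+n (low<m x<2+m x≢m x≢1+m)) | <ᵇ-true (low<m x<2+m x≢m x≢1+m) = refl
... | low x≢m x≢1+m | is-1+m refl rewrite τ-low x≢m x≢1+m | τ-1+m m
      | <ᵇ-true (ℕₚ.m<n⇒m<1+n (low<m x<2+m x≢m x≢1+m)) | <ᵇ-true (low<m x<2+m x≢m x≢1+m) = refl
... | is-m refl | low y≢m y≢1+m rewrite τ-low y≢m y≢1+m | τ-m m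
      | <ᵇ-false (ℕₚ.<⇒≤ (ℕₚ.m<n⇒m<1+n (low<m y<2+m y≢m y≢1+m))) | <ᵇ-false (ℕₚ.<⇒≤ (low<m y<2+m y≢m y≢1+m)) = refl
... | is-1+m refl | low y≢m y≢1+m rewrite τ-low y≢m y≢1+m | τ-1+m m
      | <ᵇ-false (ℕₚ.<⇒≤ (ℕₚ.m<n⇒m<1+n (low<m y<2+m y≢m y≢1+m))) | <ᵇ-false (ℕₚ.<⇒≤ (low<m y<2+m y≢m y≢1+m)) = refl
... | is-m refl | is-m refl rewrite isTop-m m = ⊥-elim (true≢false notBoth)
... | is-m refl | is-1+m refl rewrite isTop-m m | isTop-1+m m = ⊥-elim (true≢false notBoth)
... | is-1+m refl | is-m refl rewrite isTop-m m | isTop-1+m m = ⊥-elim (true≢false notBoth)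
... | is-1+m refl | is-1+m refl rewrite isTop-1+m m = ⊥-elim (true≢false notBoth)

topPair : ∀ m x y → (isTop m x ∧ isTop m y) ≡ true → x ≢ y → (x ≡ m × y ≡ suc m) ⊎ (x ≡ suc m × y ≡ m)
topPair m x y both x≢y with topCases m x | topCases m y
... | low x≢m x≢1+m | _ = ⊥-elim (true≢false (trans (sym both) (cong (_∧ isTop m y) (isTop-low x≢m x≢1+m))))
... | _ | low y≢m y≢1+m =
  ⊥-elim (true≢false (trans (sym both) (trans (cong (isTop m x ∧_) (isTop-low y≢m y≢1+m)) (∧-zeroʳ _))))
... | is-m x≡m | is-m y≡m = ⊥-elim (x≢y (trans x≡m (sym y≡m)))
... | is-1+m x≡1+m | is-1+m y≡1+m = ⊥-elim (x≢y (trans x≡1+m (sym y≡1+m)))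
... | is-m x≡m | is-1+m y≡1+m = inj₁ (x≡m , y≡1+m)
... | is-1+m x≡1+m | is-m y≡m = inj₂ (x≡1+m , y≡m)

topStart : ℕ → List ℕ → Bool
topStart m (x ∷ y ∷ _) = isTop m x ∧ isTop m y
topStart m _ = false

topEnd : ℕ → List ℕ → Bool
topEnd m (x ∷ y ∷ []) = isTop m x ∧ isTop m y
topEnd m (x ∷ y ∷ z ∷ r) = topEnd m (y ∷ z ∷ r)
topEnd m _ = false

topStart-τ : ∀ m w → topStart m (map (τ m) w) ≡ topStart m w
topStart-τ m [] = refl
topStart-τ m (x ∷ []) = refl
topStart-τ m (x ∷ y ∷ w) rewrite isTop-τ m x | isTop-τ m y = refl

topEnd-τ : ∀ m w → topEnd m (map (τ m) w) ≡ topEnd m w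
topEnd-τ m [] = refl
topEnd-τ m (x ∷ []) = refl
topEnd-τ m (x ∷ y ∷ []) rewrite isTop-τ m x | isTop-τ m y = refl
topEnd-τ m (x ∷ y ∷ z ∷ w) = topEnd-τ m (y ∷ z ∷ w)

startFactor-τ : ∀ m w a b → All (_< suc (suc m)) w → topStart m w ≡ false →
  startFactor (map (τ m) w) a b ≡ startFactor w a b
startFactor-τ m [] a b _ _ = refl
startFactor-τ m (x ∷ []) a b _ _ = refl
startFactor-τ m (x ∷ y ∷ w) a b (x< ∷ y< ∷ _) notTop = cong (λ z → if z then a else b) (τ-<ᵇ m x y x< y< notTop)

endFactor-τ : ∀ m w c d → All (_< suc (suc m)) w → topEnd m w ≡ false →
  endFactor (map (τ m) w) c d ≡ endFactor w c d
endFactor-τ m [] c d _ _ = refl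
endFactor-τ m (x ∷ []) c d _ _ = refl
endFactor-τ m (x ∷ y ∷ []) c d (x< ∷ y< ∷ _) notTop =
  cong (λ z → if z then d else c) (τ-<ᵇ m y x y< x< (trans (∧-comm (isTop m y) (isTop m x)) notTop))
endFactor-τ m (x ∷ y ∷ z ∷ w) c d (_ ∷ w<) notTop = endFactor-τ m (y ∷ z ∷ w) c d w< notTop

PkValPreserved : ℕ → List ℕ → Set
PkValPreserved m w = pk (map (τ m) w) ≡ pk w × val (map (τ m) w) ≡ val w

PkValPreserved-τ : ∀ m w → PkValPreserved m w → PkValPreserved m (map (τ m) w)
PkValPreserved-τ m w (pk≡ , val≡) rewrite map-τ-involutive m w = sym pk≡ , sym val≡

pkVal-τ-step : ∀ m x y z r → x < suc (suc m) → y < suc (suc m) → z < suc (suc m) →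
  (isTop m x ∧ isTop m y) ≡ false → (isTop m y ∧ isTop m z) ≡ false →
  PkValPreserved m (y ∷ z ∷ r) → PkValPreserved m (x ∷ y ∷ z ∷ r)
pkVal-τ-step m x y z r x< y< z< xy yz (pk≡ , val≡) =
  cong₂ (λ b n → χ b ℕ.+ n) (cong₂ _∧_ (τ-<ᵇ m x y x< y< xy) (τ-<ᵇ m z y z< y< zy)) pk≡ ,
  cong₂ (λ b n → χ b ℕ.+ n) (cong₂ _∧_ (τ-<ᵇ m y x y< x< yx) (τ-<ᵇ m y z y< z< yz)) val≡
  where
  yx = trans (∧-comm (isTop m y) (isTop m x)) xy
  zy = trans (∧-comm (isTop m z) (isTop m y)) yz

-- Inside a word, adjacent letters m and 1+m flanked by smaller letters form exactly one peak and no
-- valley, whichever their order.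
pk-↑-inside : ∀ m x u r → x < m → u < suc m → pk (x ∷ m ∷ suc m ∷ u ∷ r) ≡ suc (pk (suc m ∷ u ∷ r))
pk-↑-inside m x u r x<m u<1+m rewrite <ᵇ-true x<m | <ᵇ-false {suc m} {m} (ℕₚ.n≤1+n m)
  | <ᵇ-true (ℕₚ.n<1+n m) | <ᵇ-true u<1+m = refl

val-↑-inside : ∀ m x u r → x < m → val (x ∷ m ∷ suc m ∷ u ∷ r) ≡ val (suc m ∷ u ∷ r)
val-↑-inside m x u r x<m rewrite <ᵇ-false {m} {x} (ℕₚ.<⇒≤ x<m) | <ᵇ-false {suc m} {m} (ℕₚ.n≤1+n m) = refl

pk-↓-inside : ∀ m x r → x < suc m → pk (x ∷ suc m ∷ m ∷ r) ≡ suc (pk (m ∷ r))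
pk-↓-inside m x [] x<1+m rewrite <ᵇ-true x<1+m | <ᵇ-true (ℕₚ.n<1+n m) = refl
pk-↓-inside m x (u ∷ r) x<1+m rewrite <ᵇ-true x<1+m | <ᵇ-true (ℕₚ.n<1+n m)
  | <ᵇ-false {suc m} {m} (ℕₚ.n≤1+n m) = refl

val-↓-inside : ∀ m x u r → x < m → u ≤ m → val (x ∷ suc m ∷ m ∷ u ∷ r) ≡ val (m ∷ u ∷ r)
val-↓-inside m x u r x<m u≤m rewrite <ᵇ-false {suc m} {x} (ℕₚ.<⇒≤ (ℕₚ.m<n⇒m<1+n x<m))
  | <ᵇ-true (ℕₚ.n<1+n m) | <ᵇ-false u≤m = refl

pkVal-τ-↑ : ∀ m x u r → x < m → u < m →
  PkValPreserved m (suc m ∷ u ∷ r) → PkValPreserved m (x ∷ m ∷ suc m ∷ u ∷ r)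
pkVal-τ-↑ m x u r x<m u<m preserved
  rewrite τ-below x<m | τ-below u<m | τ-m m | τ-1+m m =
  trans (pk-↓-inside m x (u ∷ map (τ m) r) (ℕₚ.m<n⇒m<1+n x<m))
    (trans (cong suc (proj₁ preserved)) (sym (pk-↑-inside m x u r x<m (ℕₚ.m<n⇒m<1+n u<m)))) ,
  trans (val-↓-inside m x u (map (τ m) r) x<m (ℕₚ.<⇒≤ u<m))
    (trans (proj₂ preserved) (sym (val-↑-inside m x u r x<m)))

-- Applying τ turns this case into the previous one.
pkVal-τ-↓ : ∀ m x u r → x < m → u < m →
  PkValPreserved m (m ∷ u ∷ r) → PkValPreserved m (x ∷ suc m ∷ m ∷ u ∷ r)
pkVal-τ-↓ m x u r x<m u<m preserved =
  subst (PkValPreserved m) (map-τ-involutive m w)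
    (PkValPreserved-τ m (map (τ m) w)
      (subst (PkValPreserved m) (sym τw)
        (pkVal-τ-↑ m x u (map (τ m) r) x<m u<m
          (subst (PkValPreserved m) τ[m∷u∷r] (PkValPreserved-τ m (m ∷ u ∷ r) preserved)))))
  where
  w = x ∷ suc m ∷ m ∷ u ∷ r
  τ[m∷u∷r] : map (τ m) (m ∷ u ∷ r) ≡ suc m ∷ u ∷ map (τ m) r
  τ[m∷u∷r] rewrite τ-m m | τ-below u<m = refl
  τw : map (τ m) w ≡ x ∷ m ∷ suc m ∷ u ∷ map (τ m) r
  τw rewrite τ-below x<m | τ-m m | τ-1+m m | τ-below u<m = refl

-- The recursive calls are passed in as functions to keep pkVal-τ structurally recursive.
pkVal-τ-∷ : ∀ m x y z u r → x < suc (suc m) → y < suc (suc m) → z < suc (suc m) → u < suc (suc m) →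
  All (x ≢_) (y ∷ z ∷ u ∷ r) → All (y ≢_) (z ∷ u ∷ r) → All (z ≢_) (u ∷ r) → (isTop m x ∧ isTop m y) ≡ false →
  ((isTop m y ∧ isTop m z) ≡ false → PkValPreserved m (y ∷ z ∷ u ∷ r)) →
  (topStart m (z ∷ u ∷ r) ≡ false → PkValPreserved m (z ∷ u ∷ r)) →
  PkValPreserved m (x ∷ y ∷ z ∷ u ∷ r)
pkVal-τ-∷ m x y z u r x< y< z< u< x∉ y∉ z∉ notStart fromY fromZ with isTop m y ∧ isTop m z in yz
... | false = pkVal-τ-step m x y z (u ∷ r) x< y< z< notStart yz (fromY refl)
... | true with topPair m y z yz (All.head y∉)
...   | inj₁ (refl , refl) =
  pkVal-τ-↑ m x u r (low<m x< (All.head x∉) (All.head (All.tail x∉))) (low<m u< u≢m u≢1+m)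
    (fromZ (trans (cong (isTop m (suc m) ∧_) (isTop-low u≢m u≢1+m)) (∧-zeroʳ _)))
  where
  u≢m = ≢-sym (All.head (All.tail y∉))
  u≢1+m = ≢-sym (All.head z∉)
...   | inj₂ (refl , refl) =
  pkVal-τ-↓ m x u r (low<m x< (All.head (All.tail x∉)) (All.head x∉)) (low<m u< u≢m u≢1+m)
    (fromZ (trans (cong (isTop m m ∧_) (isTop-low u≢m u≢1+m)) (∧-zeroʳ _)))
  where
  u≢m = ≢-sym (All.head z∉)
  u≢1+m = ≢-sym (All.head (All.tail y∉))

pkVal-τ : ∀ m w → All (_< suc (suc m)) w → Unique w → topStart m w ≡ false → topEnd m w ≡ false →
  PkValPreserved m w
pkVal-τ m [] _ _ _ _ = refl , refl
pkVal-τ m (x ∷ []) _ _ _ _ = refl , refl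
pkVal-τ m (x ∷ y ∷ []) _ _ _ _ = refl , refl
pkVal-τ m (x ∷ y ∷ z ∷ []) (x< ∷ y< ∷ z< ∷ []) _ notStart notEnd =
  pkVal-τ-step m x y z [] x< y< z< notStart notEnd (refl , refl)
pkVal-τ m (x ∷ y ∷ z ∷ u ∷ r) (x< ∷ y< ∷ z< ∷ u< ∷ r<) (x∉ ∷ y∉ ∷ z∉ ∷ unique) notStart notEnd =
  pkVal-τ-∷ m x y z u r x< y< z< u< x∉ y∉ z∉ notStart
    (λ yz → pkVal-τ m (y ∷ z ∷ u ∷ r) (y< ∷ z< ∷ u< ∷ r<) (y∉ ∷ z∉ ∷ unique) yz notEnd)
    (λ zu → pkVal-τ m (z ∷ u ∷ r) (z< ∷ u< ∷ r<) (z∉ ∷ unique) zu notEnd)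

occurrences : ℕ → List ℕ → ℕ
occurrences x [] = 0
occurrences x (y ∷ ys) = χ (y ≡ᵇ x) ℕ.+ occurrences x ys

pairs↑ pairs↓ : ℕ → List ℕ → ℕ
pairs↑ m [] = 0
pairs↑ m (x ∷ ys) = (if x ≡ᵇ m then occurrences (suc m) ys else 0) ℕ.+ pairs↑ m ys
pairs↓ m [] = 0
pairs↓ m (x ∷ ys) = (if x ≡ᵇ suc m then occurrences m ys else 0) ℕ.+ pairs↓ m ys

χ-τ<ᵇ1+m : ∀ m y → y < suc (suc m) → χ (τ m y <ᵇ suc m) ≡ χ (y <ᵇ m) ℕ.+ χ (y ≡ᵇ suc m)
χ-τ<ᵇ1+m m y y< with topCases m y
... | low y≢m y≢1+m rewrite τ-low y≢m y≢1+m | ≡ᵇ-false y≢1+m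
  | <ᵇ-true (ℕₚ.m<n⇒m<1+n (low<m y< y≢m y≢1+m)) | <ᵇ-true (low<m y< y≢m y≢1+m) = refl
... | is-m refl rewrite τ-m m | ≡ᵇ-false {m} (≢-sym ℕₚ.1+n≢n) | <ᵇ-false {m} {m} ℕₚ.≤-refl = refl
... | is-1+m refl rewrite τ-1+m m | ≡ᵇ-refl (suc m) | <ᵇ-true (ℕₚ.n<1+n m) | <ᵇ-false {suc m} {m} (ℕₚ.n≤1+n m) = refl

χ-τ<ᵇm : ∀ m y → y < suc (suc m) → χ (τ m y <ᵇ m) ℕ.+ χ (y ≡ᵇ m) ≡ χ (y <ᵇ suc m)
χ-τ<ᵇm m y y< with topCases m y
... | low y≢m y≢1+m rewrite τ-low y≢m y≢1+m | ≡ᵇ-false y≢m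
  | <ᵇ-true (ℕₚ.m<n⇒m<1+n (low<m y< y≢m y≢1+m)) | <ᵇ-true (low<m y< y≢m y≢1+m) = refl
... | is-m refl rewrite τ-m m | ≡ᵇ-refl m | <ᵇ-true (ℕₚ.n<1+n m) | <ᵇ-false {suc m} {m} (ℕₚ.n≤1+n m) = refl
... | is-1+m refl rewrite τ-1+m m | ≡ᵇ-false {suc m} ℕₚ.1+n≢n | <ᵇ-false {m} {m} ℕₚ.≤-refl = refl

+-interchange : ∀ a b c d → a ℕ.+ b ℕ.+ (c ℕ.+ d) ≡ a ℕ.+ c ℕ.+ (b ℕ.+ d)
+-interchange = ℕ-Solver.solve-∀

countLess-τ-1+m : ∀ m ys → All (_< suc (suc m)) ys →
  countLess (suc m) (map (τ m) ys) ≡ countLess m ys ℕ.+ occurrences (suc m) ys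
countLess-τ-1+m m [] _ = refl
countLess-τ-1+m m (y ∷ ys) (y< ∷ ys<) rewrite χ-τ<ᵇ1+m m y y< | countLess-τ-1+m m ys ys< =
  +-interchange (χ (y <ᵇ m)) (χ (y ≡ᵇ suc m)) (countLess m ys) (occurrences (suc m) ys)

countLess-τ-m : ∀ m ys → All (_< suc (suc m)) ys →
  countLess m (map (τ m) ys) ℕ.+ occurrences m ys ≡ countLess (suc m) ys
countLess-τ-m m [] _ = refl
countLess-τ-m m (y ∷ ys) (y< ∷ ys<) rewrite sym (χ-τ<ᵇm m y y<) | sym (countLess-τ-m m ys ys<) =
  +-interchange (χ (τ m y <ᵇ m)) (countLess m (map (τ m) ys)) (χ (y ≡ᵇ m)) (occurrences m ys)

countLess-τ-low : ∀ m x ys → x ≢ m → x ≢ suc m → x < suc (suc m) → All (_< suc (suc m)) ys →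
  countLess x (map (τ m) ys) ≡ countLess x ys
countLess-τ-low m x [] _ _ _ _ = refl
countLess-τ-low m x (y ∷ ys) x≢m x≢1+m x< (y< ∷ ys<) =
  cong₂ ℕ._+_ (cong χ (trans (cong (τ m y <ᵇ_) (sym (τ-low x≢m x≢1+m)))
                              (τ-<ᵇ m y x y< x< (trans (cong (isTop m y ∧_) (isTop-low x≢m x≢1+m)) (∧-zeroʳ _)))))
    (countLess-τ-low m x ys x≢m x≢1+m x< ys<)

-- Swapping the values m and 1+m only changes the relative order of the occurrences of m and 1+m.
inv-τ : ∀ m w → All (_< suc (suc m)) w → inv (map (τ m) w) ℕ.+ pairs↓ m w ≡ inv w ℕ.+ pairs↑ m w
inv-τ m [] _ = refl
inv-τ m (x ∷ ys) (x< ∷ ys<) with topCases m x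
... | low x≢m x≢1+m rewrite ≡ᵇ-false x≢m | ≡ᵇ-false x≢1+m | countLess-τ-low m x ys x≢m x≢1+m x< ys< =
  shiftLow (countLess x ys) (inv ys) (inv (map (τ m) ys)) (pairs↑ m ys) (pairs↓ m ys) (inv-τ m ys ys<)
  where
  shiftLow : ∀ c i i′ a b → i′ ℕ.+ b ≡ i ℕ.+ a → c ℕ.+ i′ ℕ.+ (0 ℕ.+ b) ≡ c ℕ.+ i ℕ.+ (0 ℕ.+ a)
  shiftLow c i i′ a b h = trans (ℕₚ.+-assoc c i′ b) (trans (cong (c ℕ.+_) h) (sym (ℕₚ.+-assoc c i a)))
... | is-m refl rewrite ≡ᵇ-refl m | ≡ᵇ-false {m} (≢-sym ℕₚ.1+n≢n) | countLess-τ-1+m m ys ys< =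
  shiftM (countLess m ys) (occurrences (suc m) ys) (inv ys) (inv (map (τ m) ys)) (pairs↑ m ys) (pairs↓ m ys)
    (inv-τ m ys ys<)
  where
  shiftM : ∀ c k i i′ a b → i′ ℕ.+ b ≡ i ℕ.+ a → c ℕ.+ k ℕ.+ i′ ℕ.+ (0 ℕ.+ b) ≡ c ℕ.+ i ℕ.+ (k ℕ.+ a)
  shiftM c k i i′ a b h = begin
    c ℕ.+ k ℕ.+ i′ ℕ.+ (0 ℕ.+ b) ≡⟨ ℕₚ.+-assoc (c ℕ.+ k) i′ b ⟩
    c ℕ.+ k ℕ.+ (i′ ℕ.+ b)       ≡⟨ cong (c ℕ.+ k ℕ.+_) h ⟩
    c ℕ.+ k ℕ.+ (i ℕ.+ a)        ≡⟨ +-interchange c k i a ⟩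
    c ℕ.+ i ℕ.+ (k ℕ.+ a)        ∎
    where open ≡-Reasoning
... | is-1+m refl rewrite ≡ᵇ-refl (suc m) | ≡ᵇ-false {suc m} ℕₚ.1+n≢n | sym (countLess-τ-m m ys ys<) =
  shift1+m (countLess m (map (τ m) ys)) (occurrences m ys) (inv ys) (inv (map (τ m) ys)) (pairs↑ m ys)
    (pairs↓ m ys) (inv-τ m ys ys<)
  where
  shift1+m : ∀ c k i i′ a b → i′ ℕ.+ b ≡ i ℕ.+ a → c ℕ.+ i′ ℕ.+ (k ℕ.+ b) ≡ c ℕ.+ k ℕ.+ i ℕ.+ (0 ℕ.+ a)
  shift1+m c k i i′ a b h = begin
    c ℕ.+ i′ ℕ.+ (k ℕ.+ b)       ≡⟨ +-interchange c i′ k b ⟩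
    c ℕ.+ k ℕ.+ (i′ ℕ.+ b)       ≡⟨ cong (c ℕ.+ k ℕ.+_) h ⟩
    c ℕ.+ k ℕ.+ (i ℕ.+ a)        ≡⟨ ℕₚ.+-assoc (c ℕ.+ k) i a ⟨
    c ℕ.+ k ℕ.+ i ℕ.+ (0 ℕ.+ a)  ∎
    where open ≡-Reasoning

occurrences-∉ : ∀ {x} ys → x ∉ ys → occurrences x ys ≡ 0
occurrences-∉ [] _ = refl
occurrences-∉ {x} (y ∷ ys) x∉ rewrite ≡ᵇ-false {y} {x} (λ y≡x → x∉ (here (sym y≡x))) = occurrences-∉ ys (x∉ ∘ there)

occurrences-∈ : ∀ {x} ys → Unique ys → x ∈ ys → occurrences x ys ≡ 1
occurrences-∈ {x} (.x ∷ ys) (x∉ys ∷ _) (here refl) rewrite ≡ᵇ-refl x =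
  cong suc (occurrences-∉ ys (λ x∈ → All.lookup x∉ys x∈ refl))
occurrences-∈ {x} (y ∷ ys) (y∉ys ∷ u) (there x∈) rewrite ≡ᵇ-false {y} {x} (λ { refl → All.lookup y∉ys x∈ refl }) =
  occurrences-∈ ys u x∈

pairs↑-∉m : ∀ m ys → m ∉ ys → pairs↑ m ys ≡ 0
pairs↑-∉m m [] _ = refl
pairs↑-∉m m (y ∷ ys) m∉ rewrite ≡ᵇ-false {y} {m} (λ y≡m → m∉ (here (sym y≡m))) = pairs↑-∉m m ys (m∉ ∘ there)

pairs↑-∉1+m : ∀ m ys → suc m ∉ ys → pairs↑ m ys ≡ 0
pairs↑-∉1+m m [] _ = refl
pairs↑-∉1+m m (y ∷ ys) 1+m∉ with y ≡ᵇ m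
... | true = cong₂ ℕ._+_ (occurrences-∉ ys (1+m∉ ∘ there)) (pairs↑-∉1+m m ys (1+m∉ ∘ there))
... | false = pairs↑-∉1+m m ys (1+m∉ ∘ there)

pairs↓-∉m : ∀ m ys → m ∉ ys → pairs↓ m ys ≡ 0
pairs↓-∉m m [] _ = refl
pairs↓-∉m m (y ∷ ys) m∉ with y ≡ᵇ suc m
... | true = cong₂ ℕ._+_ (occurrences-∉ ys (m∉ ∘ there)) (pairs↓-∉m m ys (m∉ ∘ there))
... | false = pairs↓-∉m m ys (m∉ ∘ there)

pairs↓-∉1+m : ∀ m ys → suc m ∉ ys → pairs↓ m ys ≡ 0
pairs↓-∉1+m m [] _ = refl
pairs↓-∉1+m m (y ∷ ys) 1+m∉ rewrite ≡ᵇ-false {y} {suc m} (λ y≡1+m → 1+m∉ (here (sym y≡1+m))) =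
  pairs↓-∉1+m m ys (1+m∉ ∘ there)

pairs↑⊎pairs↓ : ∀ m w → Unique w → m ∈ w → suc m ∈ w →
  (pairs↑ m w ≡ 1 × pairs↓ m w ≡ 0) ⊎ (pairs↑ m w ≡ 0 × pairs↓ m w ≡ 1)
pairs↑⊎pairs↓ m (x ∷ ys) u m∈ 1+m∈ with topCases m x
pairs↑⊎pairs↓ m (x ∷ ys) (x∉ys ∷ u) m∈ (here 1+m≡x) | is-m refl = ⊥-elim (ℕₚ.1+n≢n 1+m≡x)
pairs↑⊎pairs↓ m (x ∷ ys) (x∉ys ∷ u) m∈ (there 1+m∈) | is-m refl
  rewrite ≡ᵇ-refl m | ≡ᵇ-false {m} (≢-sym ℕₚ.1+n≢n) =
  inj₁ (cong₂ ℕ._+_ (occurrences-∈ ys u 1+m∈) (pairs↑-∉m m ys m∉ys) , pairs↓-∉m m ys m∉ys)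
  where m∉ys = λ m∈ → All.lookup x∉ys m∈ refl
pairs↑⊎pairs↓ m (x ∷ ys) (x∉ys ∷ u) (here m≡x) 1+m∈ | is-1+m refl = ⊥-elim (ℕₚ.1+n≢n (sym m≡x))
pairs↑⊎pairs↓ m (x ∷ ys) (x∉ys ∷ u) (there m∈) 1+m∈ | is-1+m refl
  rewrite ≡ᵇ-refl (suc m) | ≡ᵇ-false {suc m} ℕₚ.1+n≢n =
  inj₂ (pairs↑-∉1+m m ys 1+m∉ys , cong₂ ℕ._+_ (occurrences-∈ ys u m∈) (pairs↓-∉1+m m ys 1+m∉ys))
  where 1+m∉ys = λ 1+m∈ → All.lookup x∉ys 1+m∈ refl
pairs↑⊎pairs↓ m (x ∷ ys) _ (here m≡x) _ | low x≢m _ = ⊥-elim (x≢m (sym m≡x))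
pairs↑⊎pairs↓ m (x ∷ ys) _ (there _) (here 1+m≡x) | low _ x≢1+m = ⊥-elim (x≢1+m (sym 1+m≡x))
pairs↑⊎pairs↓ m (x ∷ ys) (_ ∷ u) (there m∈) (there 1+m∈) | low x≢m x≢1+m
  rewrite ≡ᵇ-false x≢m | ≡ᵇ-false x≢1+m = pairs↑⊎pairs↓ m ys u m∈ 1+m∈

-1ℤ^-+1 : ∀ k → -1ℤ ^ (k ℕ.+ 1) ≡ - (-1ℤ ^ k)
-1ℤ^-+1 k = trans (ℤₚ.^-distribˡ-+-* -1ℤ k 1) (s*[-1*1]≡-s (-1ℤ ^ k))
  where
  s*[-1*1]≡-s : ∀ s → s * (-1ℤ * + 1) ≡ - s
  s*[-1*1]≡-s = ℤ-Solver.solve-∀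

sign-τ : ∀ m w → All (_< suc (suc m)) w → Unique w → m ∈ w → suc m ∈ w → sign (map (τ m) w) ≡ - sign w
sign-τ m w w< u m∈ 1+m∈ with pairs↑⊎pairs↓ m w u m∈ 1+m∈ | inv-τ m w w<
... | inj₁ (↑≡1 , ↓≡0) | invs rewrite ↑≡1 | ↓≡0 =
  trans (cong (-1ℤ ^_) (trans (sym (ℕₚ.+-identityʳ _)) invs)) (-1ℤ^-+1 (inv w))
... | inj₂ (↑≡0 , ↓≡1) | invs rewrite ↑≡0 | ↓≡1 =
  trans (sym (ℤₚ.neg-involutive _))
    (cong -_ (sym (trans (cong (-1ℤ ^_) (trans (sym (ℕₚ.+-identityʳ _)) (sym invs))) (-1ℤ^-+1 (inv (map (τ m) w))))))

weight-τ : ∀ p q a b c d m w → IsPermWord (suc (suc m)) w → topStart m w ≡ false → topEnd m w ≡ false →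
  weight p q a b c d (map (τ m) w) ≡ - weight p q a b c d w
weight-τ p q a b c d m w isPerm@(_ , w< , unique) notStart notEnd = begin
  weight p q a b c d (map (τ m) w)
    ≡⟨ weight-≡ p q a b c d (map (τ m) w) refl (proj₁ pkVal) (proj₂ pkVal)
         (startFactor-τ m w a b w< notStart) (endFactor-τ m w c d w< notEnd) ⟩
  sign (map (τ m) w) * p ^ pk w * q ^ val w * startFactor w a b * endFactor w c d
    ≡⟨ cong (λ s → s * p ^ pk w * q ^ val w * startFactor w a b * endFactor w c d)
         (sign-τ m w w< unique (secondLargest∈permWord m w isPerm) (largest∈permWord isPerm)) ⟩
  - sign w * p ^ pk w * q ^ val w * startFactor w a b * endFactor w c d
    ≡⟨ neg-out (sign w) (p ^ pk w) (q ^ val w) (startFactor w a b) (endFactor w c d) ⟩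
  - weight p q a b c d w ∎
  where
  open ≡-Reasoning
  pkVal = pkVal-τ m w w< unique notStart notEnd
  neg-out : ∀ s P V S E → - s * P * V * S * E ≡ - (s * P * V * S * E)
  neg-out = ℤ-Solver.solve-∀

-- Decomposition according to the position of the two largest letters

All<⇒All≢ : ∀ {m k} w → All (_< m) w → m ≤ k → All (k ≢_) w
All<⇒All≢ [] [] _ = []
All<⇒All≢ (r ∷ w) (r<m ∷ w<m) m≤k =
  (λ k≡r → ℕₚ.<-irrefl refl (ℕₚ.<-≤-trans r<m (subst (_ ≤_) k≡r m≤k))) ∷ All<⇒All≢ w w<m m≤k

All≢top⇒All< : ∀ {m} w → All (_< suc (suc m)) w → All (m ≢_) w → All (suc m ≢_) w → All (_< m) w
All≢top⇒All< [] [] [] [] = []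
All≢top⇒All< (r ∷ w) (r< ∷ w<) (m≢r ∷ m≢w) (1+m≢r ∷ 1+m≢w) =
  low<m r< (≢-sym m≢r) (≢-sym 1+m≢r) ∷ All≢top⇒All< w w< m≢w 1+m≢w

m<2+m : ∀ m → m < suc (suc m)
m<2+m m = ℕₚ.m<n⇒m<1+n (ℕₚ.n<1+n m)

All<2+ : ∀ {m} w → All (_< m) w → All (_< suc (suc m)) w
All<2+ w = All.map (ℕₚ.m<n⇒m<1+n ∘ ℕₚ.m<n⇒m<1+n)

IsPermWord-↑∷ : ∀ m w → IsPermWord m w → IsPermWord (suc (suc m)) (m ∷ suc m ∷ w)
IsPermWord-↑∷ m w (len , w<m , unique) =
  cong (suc ∘ suc) len , m<2+m m ∷ ℕₚ.n<1+n _ ∷ All<2+ w w<m ,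
  (≢-sym ℕₚ.1+n≢n ∷ All<⇒All≢ w w<m ℕₚ.≤-refl) ∷ All<⇒All≢ w w<m (ℕₚ.n≤1+n m) ∷ unique

IsPermWord-↓∷ : ∀ m w → IsPermWord m w → IsPermWord (suc (suc m)) (suc m ∷ m ∷ w)
IsPermWord-↓∷ m w (len , w<m , unique) =
  cong (suc ∘ suc) len , ℕₚ.n<1+n _ ∷ m<2+m m ∷ All<2+ w w<m ,
  (ℕₚ.1+n≢n ∷ All<⇒All≢ w w<m (ℕₚ.n≤1+n m)) ∷ All<⇒All≢ w w<m ℕₚ.≤-refl ∷ unique

IsPermWord-++ : ∀ m w x y → IsPermWord m w → x < suc (suc m) → y < suc (suc m) → x ≢ y → m ≤ x → m ≤ y →
  IsPermWord (suc (suc m)) (w ++ x ∷ y ∷ [])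
IsPermWord-++ m w x y (len , w<m , unique) x< y< x≢y m≤x m≤y =
  trans (Listₚ.length-++ w) (trans (cong (ℕ._+ 2) len) (ℕₚ.+-comm m 2)) ,
  Allₚ.++⁺ (All<2+ w w<m) (x< ∷ y< ∷ []) ,
  Uniqueₚ.++⁺ unique ((x≢y ∷ []) ∷ [] ∷ []) disjoint
  where
  disjoint : Disjoint w (x ∷ y ∷ [])
  disjoint (r∈w , here refl) = All.lookup (All<⇒All≢ w w<m m≤x) r∈w refl
  disjoint (r∈w , there (here refl)) = All.lookup (All<⇒All≢ w w<m m≤y) r∈w refl

IsPermWord-++↑ : ∀ m w → IsPermWord m w → IsPermWord (suc (suc m)) (w ++ m ∷ suc m ∷ [])
IsPermWord-++↑ m w isPerm =
  IsPermWord-++ m w m (suc m) isPerm (m<2+m m) (ℕₚ.n<1+n _) (≢-sym ℕₚ.1+n≢n) ℕₚ.≤-refl (ℕₚ.n≤1+n m)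

IsPermWord-++↓ : ∀ m w → IsPermWord m w → IsPermWord (suc (suc m)) (w ++ suc m ∷ m ∷ [])
IsPermWord-++↓ m w isPerm =
  IsPermWord-++ m w (suc m) m isPerm (ℕₚ.n<1+n _) (m<2+m m) ℕₚ.1+n≢n (ℕₚ.n≤1+n m) ℕₚ.≤-refl

startingWithTop endingWithTop topInside : ℕ → List (List ℕ)
startingWithTop m = filterᵇ (topStart m) (permWords (suc (suc m)))
endingWithTop m = filterᵇ (topEnd m) (filterᵇ (not ∘ topStart m) (permWords (suc (suc m))))
topInside m = filterᵇ (not ∘ topEnd m) (filterᵇ (not ∘ topStart m) (permWords (suc (suc m))))

↑∷ ↓∷ ++↑ ++↓ : ℕ → List ℕ → List ℕ
↑∷ m w = m ∷ suc m ∷ w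
↓∷ m w = suc m ∷ m ∷ w
++↑ m w = w ++ m ∷ suc m ∷ []
++↓ m w = w ++ suc m ∷ m ∷ []

topPrefixed topSuffixed : ℕ → List (List ℕ)
topPrefixed m = map (↑∷ m) (permWords m) ++ map (↓∷ m) (permWords m)
topSuffixed m = map (++↑ m) (permWords m) ++ map (++↓ m) (permWords m)

startingWithTop⊆topPrefixed : ∀ m {w} → w ∈ startingWithTop m → w ∈ topPrefixed m
startingWithTop⊆topPrefixed m {w} w∈ with ∈-filterᵇ⁻ (topStart m) (permWords (suc (suc m))) w∈
... | w∈perms , start with w | ∈-permWords⁻ w∈perms
... | [] | _ = ⊥-elim (true≢false (sym start))
... | x ∷ [] | _ = ⊥-elim (true≢false (sym start))
... | x ∷ y ∷ ρ | len , (_ ∷ _ ∷ ρ<) , (x∉ ∷ y∉ ∷ unique) with topPair m x y start (All.head x∉)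
...   | inj₁ (refl , refl) = ∈-++⁺ˡ (∈-map⁺ _ (∈-permWords⁺
        (ℕₚ.suc-injective (ℕₚ.suc-injective len) , All≢top⇒All< ρ ρ< (All.tail x∉) y∉ , unique)))
...   | inj₂ (refl , refl) = ∈-++⁺ʳ _ (∈-map⁺ _ (∈-permWords⁺
        (ℕₚ.suc-injective (ℕₚ.suc-injective len) , All≢top⇒All< ρ ρ< y∉ (All.tail x∉) , unique)))

topPrefixed⊆startingWithTop : ∀ m {w} → w ∈ topPrefixed m → w ∈ startingWithTop m
topPrefixed⊆startingWithTop m w∈ with ∈-++⁻ (map (↑∷ m) (permWords m)) w∈
... | inj₁ w∈↑ with ∈-map⁻ _ w∈↑
...   | ρ , ρ∈ , refl = ∈-filterᵇ⁺ (topStart m) (∈-permWords⁺ (IsPermWord-↑∷ m ρ (∈-permWords⁻ ρ∈)))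
                          (cong₂ _∧_ (isTop-m m) (isTop-1+m m))
topPrefixed⊆startingWithTop m w∈ | inj₂ w∈↓ with ∈-map⁻ _ w∈↓
...   | ρ , ρ∈ , refl = ∈-filterᵇ⁺ (topStart m) (∈-permWords⁺ (IsPermWord-↓∷ m ρ (∈-permWords⁻ ρ∈)))
                          (cong₂ _∧_ (isTop-1+m m) (isTop-m m))

topPrefixed-unique : ∀ m → Unique (topPrefixed m)
topPrefixed-unique m = Uniqueₚ.++⁺ (Uniqueₚ.map⁺ ∷∷-injective (permWords-unique m))
  (Uniqueₚ.map⁺ ∷∷-injective (permWords-unique m)) disjoint
  where
  ∷∷-injective : ∀ {x y : ℕ} {u v} → x ∷ y ∷ u ≡ x ∷ y ∷ v → u ≡ v
  ∷∷-injective = Listₚ.∷-injectiveʳ ∘ Listₚ.∷-injectiveʳ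
  disjoint : Disjoint (map (↑∷ m) (permWords m)) (map (↓∷ m) (permWords m))
  disjoint (w∈↑ , w∈↓) with ∈-map⁻ _ w∈↑ | ∈-map⁻ _ w∈↓
  ... | _ , _ , refl | _ , _ , eq = ℕₚ.1+n≢n (sym (Listₚ.∷-injectiveˡ eq))

topEnd-++ : ∀ m w x y → topEnd m (w ++ x ∷ y ∷ []) ≡ (isTop m x ∧ isTop m y)
topEnd-++ m [] x y = refl
topEnd-++ m (r ∷ []) x y = refl
topEnd-++ m (r ∷ s ∷ []) x y = refl
topEnd-++ m (r ∷ s ∷ t ∷ w) x y = topEnd-++ m (s ∷ t ∷ w) x y

topEnd-split : ∀ m w → topEnd m w ≡ true → Σ (List ℕ) λ ρ → Σ ℕ λ x → Σ ℕ λ y →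
  w ≡ ρ ++ x ∷ y ∷ [] × (isTop m x ∧ isTop m y) ≡ true
topEnd-split m (x ∷ y ∷ []) end = [] , x , y , refl , end
topEnd-split m (x ∷ y ∷ z ∷ r) end with topEnd-split m (y ∷ z ∷ r) end
... | ρ , a , b , eq , ab = x ∷ ρ , a , b , cong (x ∷_) eq , ab

topStart-++ : ∀ m r w x y → r < m → topStart m ((r ∷ w) ++ x ∷ y ∷ []) ≡ false
topStart-++ m r [] x y r<m rewrite isTop-low {m} (ℕₚ.<⇒≢ r<m) (ℕₚ.<⇒≢ (ℕₚ.m<n⇒m<1+n r<m)) = refl
topStart-++ m r (s ∷ w) x y r<m rewrite isTop-low {m} (ℕₚ.<⇒≢ r<m) (ℕₚ.<⇒≢ (ℕₚ.m<n⇒m<1+n r<m)) = refl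

unique-++⁻ : ∀ (w v : List ℕ) → Unique (w ++ v) → Unique w × Unique v × All (λ r → All (r ≢_) v) w
unique-++⁻ [] v unique = [] , unique , []
unique-++⁻ (r ∷ w) v (r∉ ∷ unique) with Allₚ.++⁻ w r∉ | unique-++⁻ w v unique
... | r∉w , r∉v | uw , uv , w∉v = (r∉w ∷ uw) , uv , (r∉v ∷ w∉v)

length-++∷∷ : ∀ (w : List ℕ) {x y m} → length (w ++ x ∷ y ∷ []) ≡ suc (suc m) → length w ≡ m
length-++∷∷ w {m = m} e = ℕₚ.+-cancelʳ-≡ 2 (length w) m (trans (sym (Listₚ.length-++ w)) (trans e (ℕₚ.+-comm 2 m)))

endingWithTop⊆topSuffixed : ∀ m {w} → w ∈ endingWithTop m → w ∈ topSuffixed m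
endingWithTop⊆topSuffixed m {w} w∈
  with ∈-filterᵇ⁻ (topEnd m) (filterᵇ (not ∘ topStart m) (permWords (suc (suc m)))) w∈
... | w∈′ , end with ∈-filterᵇ⁻ (not ∘ topStart m) (permWords (suc (suc m))) w∈′
... | w∈perms , _ with topEnd-split m w end
... | ρ , x , y , refl , xy with ∈-permWords⁻ w∈perms
... | len , w< , unique with unique-++⁻ ρ (x ∷ y ∷ []) unique
... | uρ , (x∉y ∷ _) , ρ∉xy with Allₚ.++⁻ ρ w< | topPair m x y xy (All.head x∉y)
...   | ρ< , _ | inj₁ (refl , refl) = ∈-++⁺ˡ (∈-map⁺ _ (∈-permWords⁺ (length-++∷∷ ρ len ,
        All≢top⇒All< ρ ρ< (All.map (≢-sym ∘ All.head) ρ∉xy) (All.map (≢-sym ∘ All.head ∘ All.tail) ρ∉xy) , uρ)))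
...   | ρ< , _ | inj₂ (refl , refl) = ∈-++⁺ʳ _ (∈-map⁺ _ (∈-permWords⁺ (length-++∷∷ ρ len ,
        All≢top⇒All< ρ ρ< (All.map (≢-sym ∘ All.head ∘ All.tail) ρ∉xy) (All.map (≢-sym ∘ All.head) ρ∉xy) , uρ)))

∈-endingWithTop : ∀ m ρ x y → 1 ≤ m → IsPermWord m ρ → (isTop m x ∧ isTop m y) ≡ true →
  IsPermWord (suc (suc m)) (ρ ++ x ∷ y ∷ []) → (ρ ++ x ∷ y ∷ []) ∈ endingWithTop m
∈-endingWithTop m [] x y 1≤m (len , _) _ _ = ⊥-elim (ℕₚ.1+n≰n (subst (1 ≤_) (sym len) 1≤m))
∈-endingWithTop m (r ∷ ρ) x y _ (_ , r<m ∷ _ , _) xy isPerm =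
  ∈-filterᵇ⁺ (topEnd m)
    (∈-filterᵇ⁺ (not ∘ topStart m) (∈-permWords⁺ isPerm) (cong not (topStart-++ m r ρ x y r<m)))
    (trans (topEnd-++ m (r ∷ ρ) x y) xy)

topSuffixed⊆endingWithTop : ∀ m {w} → 1 ≤ m → w ∈ topSuffixed m → w ∈ endingWithTop m
topSuffixed⊆endingWithTop m 1≤m w∈ with ∈-++⁻ (map (++↑ m) (permWords m)) w∈
... | inj₁ w∈↑ with ∈-map⁻ _ w∈↑
...   | ρ , ρ∈ , refl = ∈-endingWithTop m ρ m (suc m) 1≤m (∈-permWords⁻ ρ∈)
                          (cong₂ _∧_ (isTop-m m) (isTop-1+m m)) (IsPermWord-++↑ m ρ (∈-permWords⁻ ρ∈))
topSuffixed⊆endingWithTop m 1≤m w∈ | inj₂ w∈↓ with ∈-map⁻ _ w∈↓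
...   | ρ , ρ∈ , refl = ∈-endingWithTop m ρ (suc m) m 1≤m (∈-permWords⁻ ρ∈)
                          (cong₂ _∧_ (isTop-1+m m) (isTop-m m)) (IsPermWord-++↓ m ρ (∈-permWords⁻ ρ∈))

topSuffixed-unique : ∀ m → Unique (topSuffixed m)
topSuffixed-unique m = Uniqueₚ.++⁺
  (Uniqueₚ.map⁺ (λ {u} {v} → Listₚ.++-cancelʳ (m ∷ suc m ∷ []) u v) (permWords-unique m))
  (Uniqueₚ.map⁺ (λ {u} {v} → Listₚ.++-cancelʳ (suc m ∷ m ∷ []) u v) (permWords-unique m))
  disjoint
  where
  -- endFactor _ (+ 0) (+ 1) detects whether a word ends with a descent.
  disjoint : Disjoint (map (++↑ m) (permWords m)) (map (++↓ m) (permWords m))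
  disjoint (w∈↑ , w∈↓) with ∈-map⁻ _ w∈↑ | ∈-map⁻ _ w∈↓
  ... | ρ , _ , refl | ρ′ , _ , eq = 0≢1 (begin
    + 0                                     ≡⟨ cong (λ b → if b then + 1 else + 0) (<ᵇ-false (ℕₚ.n≤1+n m)) ⟨
    (if suc m <ᵇ m then + 1 else + 0)       ≡⟨ endFactor-++ ρ m (suc m) (+ 0) (+ 1) ⟨
    endFactor (++↑ m ρ) (+ 0) (+ 1)         ≡⟨ cong (λ w → endFactor w (+ 0) (+ 1)) eq ⟩
    endFactor (++↓ m ρ′) (+ 0) (+ 1)        ≡⟨ endFactor-++ ρ′ (suc m) m (+ 0) (+ 1) ⟩
    (if m <ᵇ suc m then + 1 else + 0)       ≡⟨ cong (λ b → if b then + 1 else + 0) (<ᵇ-true (ℕₚ.n<1+n m)) ⟩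
    + 1                                     ∎)
    where
    open ≡-Reasoning
    0≢1 : + 0 ≢ + 1
    0≢1 ()

startingWithTop-unique : ∀ m → Unique (startingWithTop m)
startingWithTop-unique m = filterᵇ-unique (topStart m) (permWords-unique (suc (suc m)))

endingWithTop-unique : ∀ m → Unique (endingWithTop m)
endingWithTop-unique m = filterᵇ-unique (topEnd m) (filterᵇ-unique (not ∘ topStart m) (permWords-unique (suc (suc m))))

topInside-unique : ∀ m → Unique (topInside m)
topInside-unique m =
  filterᵇ-unique (not ∘ topEnd m) (filterᵇ-unique (not ∘ topStart m) (permWords-unique (suc (suc m))))

∈-topInside⁻ : ∀ m {w} → w ∈ topInside m →
  IsPermWord (suc (suc m)) w × topStart m w ≡ false × topEnd m w ≡ false
∈-topInside⁻ m w∈ with ∈-filterᵇ⁻ (not ∘ topEnd m) (filterᵇ (not ∘ topStart m) (permWords (suc (suc m)))) w∈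
... | w∈′ , notEnd with ∈-filterᵇ⁻ (not ∘ topStart m) (permWords (suc (suc m))) w∈′
... | w∈perms , notStart = ∈-permWords⁻ w∈perms , not≡true⇒≡false notStart , not≡true⇒≡false notEnd

∈-topInside⁺ : ∀ m {w} → IsPermWord (suc (suc m)) w → topStart m w ≡ false → topEnd m w ≡ false →
  w ∈ topInside m
∈-topInside⁺ m isPerm notStart notEnd =
  ∈-filterᵇ⁺ (not ∘ topEnd m) (∈-filterᵇ⁺ (not ∘ topStart m) (∈-permWords⁺ isPerm) (cong not notStart))
    (cong not notEnd)

τ-∈-topInside : ∀ m {w} → w ∈ topInside m → map (τ m) w ∈ topInside m
τ-∈-topInside m {w} w∈ with ∈-topInside⁻ m w∈
... | isPerm , notStart , notEnd =
  ∈-topInside⁺ m (IsPermWord-τ m w isPerm) (trans (topStart-τ m w) notStart) (trans (topEnd-τ m w) notEnd)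

Σ-topInside≡0 : ∀ p q a b c d m → Σℤ (weight p q a b c d) (topInside m) ≡ + 0
Σ-topInside≡0 p q a b c d m = x≡-x⇒x≡0 _ (begin
  Σℤ ω (topInside m)                   ≡⟨ Σℤ-sameElements ω (topInside-unique m) τ[topInside]-unique τ-image τ-preimage ⟩
  Σℤ ω (map (map (τ m)) (topInside m))  ≡⟨ Σℤ-map ω (map (τ m)) (topInside m) ⟩
  Σℤ (ω ∘ map (τ m)) (topInside m)      ≡⟨ Σℤ-cong (topInside m) ω-τ ⟩
  Σℤ (λ w → - ω w) (topInside m)        ≡⟨ Σℤ-neg ω (topInside m) ⟩
  - Σℤ ω (topInside m)                  ∎)
  where
  open ≡-Reasoning
  ω = weight p q a b c d
  τ[topInside]-unique : Unique (map (map (τ m)) (topInside m))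
  τ[topInside]-unique = Uniqueₚ.map⁺ (λ {u} {v} e →
    trans (sym (map-τ-involutive m u)) (trans (cong (map (τ m)) e) (map-τ-involutive m v))) (topInside-unique m)
  τ-image : ∀ {w} → w ∈ topInside m → w ∈ map (map (τ m)) (topInside m)
  τ-image {w} w∈ = subst (_∈ map (map (τ m)) (topInside m)) (map-τ-involutive m w)
    (∈-map⁺ (map (τ m)) (τ-∈-topInside m w∈))
  τ-preimage : ∀ {w} → w ∈ map (map (τ m)) (topInside m) → w ∈ topInside m
  τ-preimage w∈ with ∈-map⁻ (map (τ m)) w∈
  ... | v , v∈ , refl = τ-∈-topInside m v∈
  ω-τ : ∀ {w} → w ∈ topInside m → ω (map (τ m) w) ≡ - ω w
  ω-τ {w} w∈ with ∈-topInside⁻ m w∈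
  ... | isPerm , notStart , notEnd = weight-τ p q a b c d m w isPerm notStart notEnd

permWord-∷∷ : ∀ n w → w ∈ permWords (suc (suc n)) →
  Σ ℕ λ r₁ → Σ ℕ λ r₂ → Σ (List ℕ) λ ρ → w ≡ r₁ ∷ r₂ ∷ ρ × All (_< suc (suc n)) w
permWord-∷∷ n w w∈ with w | ∈-permWords⁻ w∈
... | r₁ ∷ r₂ ∷ ρ | _ , w< , _ = r₁ , r₂ , ρ , refl , w<

Σ-startingWithTop : ∀ p q a b c d n → let m = suc (suc n) in
  Σℤ (weight p q a b c d) (startingWithTop m) ≡ (p * a - b) * Φ p q q (+ 1) c d m
Σ-startingWithTop p q a b c d n = begin
  Σℤ ω (startingWithTop m)
    ≡⟨ Σℤ-sameElements ω (startingWithTop-unique m) (topPrefixed-unique m)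
         (startingWithTop⊆topPrefixed m) (topPrefixed⊆startingWithTop m) ⟩
  Σℤ ω (map (↑∷ m) (permWords m) ++ map (↓∷ m) (permWords m))
    ≡⟨ Σℤ-++ ω (map (↑∷ m) (permWords m)) (map (↓∷ m) (permWords m)) ⟩
  Σℤ ω (map (↑∷ m) (permWords m)) + Σℤ ω (map (↓∷ m) (permWords m))
    ≡⟨ cong₂ _+_ (Σℤ-map ω (↑∷ m) (permWords m)) (Σℤ-map ω (↓∷ m) (permWords m)) ⟩
  Σℤ (ω ∘ ↑∷ m) (permWords m) + Σℤ (ω ∘ ↓∷ m) (permWords m)
    ≡⟨ cong₂ _+_ (Σℤ-cong (permWords m) ω-↑∷) (Σℤ-cong (permWords m) ω-↓∷) ⟩
  Σℤ (λ ρ → p * a * ω′ ρ) (permWords m) + Σℤ (λ ρ → - b * ω′ ρ) (permWords m)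
    ≡⟨ cong₂ _+_ (Σℤ-*ˡ (p * a) ω′ (permWords m)) (Σℤ-*ˡ (- b) ω′ (permWords m)) ⟩
  p * a * Φ p q q (+ 1) c d m + - b * Φ p q q (+ 1) c d m
    ≡⟨ ℤₚ.*-distribʳ-+ (Φ p q q (+ 1) c d m) (p * a) (- b) ⟨
  (p * a - b) * Φ p q q (+ 1) c d m ∎
  where
  open ≡-Reasoning
  m = suc (suc n)
  ω = weight p q a b c d
  ω′ = weight p q q (+ 1) c d
  ω-↑∷ : ∀ {ρ} → ρ ∈ permWords m → ω (↑∷ m ρ) ≡ p * a * ω′ ρ
  ω-↑∷ {ρ} ρ∈ with permWord-∷∷ n ρ ρ∈
  ... | r₁ , r₂ , ρ′ , refl , ρ< = weight-↑∷ p q a b c d m r₁ r₂ ρ′ ρ<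
  ω-↓∷ : ∀ {ρ} → ρ ∈ permWords m → ω (↓∷ m ρ) ≡ - b * ω′ ρ
  ω-↓∷ {ρ} ρ∈ with permWord-∷∷ n ρ ρ∈
  ... | r₁ , r₂ , ρ′ , refl , ρ< = weight-↓∷ p q a b c d m r₁ r₂ ρ′ ρ<

Σ-endingWithTop : ∀ p q a b c d n → let m = suc (suc n) in
  Σℤ (weight p q a b c d) (endingWithTop m) ≡ (c - p * d) * Φ p q a b (+ 1) q m
Σ-endingWithTop p q a b c d n = begin
  Σℤ ω (endingWithTop m)
    ≡⟨ Σℤ-sameElements ω (endingWithTop-unique m) (topSuffixed-unique m)
         (endingWithTop⊆topSuffixed m) (topSuffixed⊆endingWithTop m (s≤s z≤n)) ⟩
  Σℤ ω (map (++↑ m) (permWords m) ++ map (++↓ m) (permWords m))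
    ≡⟨ Σℤ-++ ω (map (++↑ m) (permWords m)) (map (++↓ m) (permWords m)) ⟩
  Σℤ ω (map (++↑ m) (permWords m)) + Σℤ ω (map (++↓ m) (permWords m))
    ≡⟨ cong₂ _+_ (Σℤ-map ω (++↑ m) (permWords m)) (Σℤ-map ω (++↓ m) (permWords m)) ⟩
  Σℤ (ω ∘ ++↑ m) (permWords m) + Σℤ (ω ∘ ++↓ m) (permWords m)
    ≡⟨ cong₂ _+_ (Σℤ-cong (permWords m) ω-++↑) (Σℤ-cong (permWords m) ω-++↓) ⟩
  Σℤ (λ ρ → c * ω′ ρ) (permWords m) + Σℤ (λ ρ → - (p * d) * ω′ ρ) (permWords m)
    ≡⟨ cong₂ _+_ (Σℤ-*ˡ c ω′ (permWords m)) (Σℤ-*ˡ (- (p * d)) ω′ (permWords m)) ⟩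
  c * Φ p q a b (+ 1) q m + - (p * d) * Φ p q a b (+ 1) q m
    ≡⟨ ℤₚ.*-distribʳ-+ (Φ p q a b (+ 1) q m) c (- (p * d)) ⟨
  (c - p * d) * Φ p q a b (+ 1) q m ∎
  where
  open ≡-Reasoning
  m = suc (suc n)
  ω = weight p q a b c d
  ω′ = weight p q a b (+ 1) q
  ω-++↑ : ∀ {ρ} → ρ ∈ permWords m → ω (++↑ m ρ) ≡ c * ω′ ρ
  ω-++↑ {ρ} ρ∈ with permWord-∷∷ n ρ ρ∈
  ... | r₁ , r₂ , ρ′ , refl , ρ< = weight-++↑ p q a b c d m r₁ r₂ ρ′ ρ<
  ω-++↓ : ∀ {ρ} → ρ ∈ permWords m → ω (++↓ m ρ) ≡ - (p * d) * ω′ ρ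
  ω-++↓ {ρ} ρ∈ with permWord-∷∷ n ρ ρ∈
  ... | r₁ , r₂ , ρ′ , refl , ρ< = weight-++↓ p q a b c d m r₁ r₂ ρ′ ρ<

Φ-recurrence : ∀ p q a b c d n → let m = suc (suc n) in
  Φ p q a b c d (suc (suc m)) ≡ (p * a - b) * Φ p q q (+ 1) c d m + (c - p * d) * Φ p q a b (+ 1) q m
Φ-recurrence p q a b c d n = begin
  Σℤ ω (permWords (suc (suc m)))
    ≡⟨ Σℤ-partition ω (topStart m) (permWords (suc (suc m))) ⟩
  Σℤ ω (startingWithTop m) + Σℤ ω (filterᵇ (not ∘ topStart m) (permWords (suc (suc m))))
    ≡⟨ cong (_+_ (Σℤ ω (startingWithTop m)))
         (Σℤ-partition ω (topEnd m) (filterᵇ (not ∘ topStart m) (permWords (suc (suc m))))) ⟩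
  Σℤ ω (startingWithTop m) + (Σℤ ω (endingWithTop m) + Σℤ ω (topInside m))
    ≡⟨ cong₂ (λ s e → s + (e + Σℤ ω (topInside m))) (Σ-startingWithTop p q a b c d n) (Σ-endingWithTop p q a b c d n) ⟩
  S + (E + Σℤ ω (topInside m))
    ≡⟨ cong (λ i → S + (E + i)) (Σ-topInside≡0 p q a b c d m) ⟩
  S + (E + + 0)
    ≡⟨ cong (_+_ S) (ℤₚ.+-identityʳ E) ⟩
  S + E ∎
  where
  open ≡-Reasoning
  m = suc (suc n)
  ω = weight p q a b c d
  S = (p * a - b) * Φ p q q (+ 1) c d m
  E = (c - p * d) * Φ p q a b (+ 1) q m

-- Closed form

Φ-2 : ∀ p q a b c d → Φ p q a b c d 2 ≡ a * c - b * d
Φ-2 p q a b c d = trans expand (simplify a b c d)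
  where
  expand : Φ p q a b c d 2 ≡ + 1 * + 1 * + 1 * a * c + (-1ℤ * + 1 * + 1 * b * d + + 0)
  expand = refl
  simplify : ∀ a b c d → + 1 * + 1 * + 1 * a * c + (-1ℤ * + 1 * + 1 * b * d + + 0) ≡ a * c - b * d
  simplify = ℤ-Solver.solve-∀

Φ-3 : ∀ p q a b c d → Φ p q a b c d 3 ≡ a * c - b * d
Φ-3 p q a b c d = trans expand (simplify a b c d p q)
  where
  expand : Φ p q a b c d 3 ≡ + 1 * + 1 * + 1 * a * c + (-1ℤ * (p * + 1) * + 1 * a * d + (-1ℤ * + 1 * (q * + 1) * b * c
    + (+ 1 * (p * + 1) * + 1 * a * d + (+ 1 * + 1 * (q * + 1) * b * c + (-1ℤ * + 1 * + 1 * b * d + + 0)))))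
  expand = refl
  simplify : ∀ a b c d p q → + 1 * + 1 * + 1 * a * c + (-1ℤ * (p * + 1) * + 1 * a * d + (-1ℤ * + 1 * (q * + 1) * b * c
    + (+ 1 * (p * + 1) * + 1 * a * d + (+ 1 * + 1 * (q * + 1) * b * c + (-1ℤ * + 1 * + 1 * b * d + + 0)))))
    ≡ a * c - b * d
  simplify = ℤ-Solver.solve-∀

_×4+_ : ℕ → ℕ → ℕ
zero ×4+ e = e
suc j ×4+ e = suc (suc (suc (suc (j ×4+ e))))

×4+-≡ : ∀ j e → 4 ℕ.* j ℕ.+ e ≡ j ×4+ e
×4+-≡ zero e = refl
×4+-≡ (suc j) e = trans (shift j e) (cong (suc ∘ suc ∘ suc ∘ suc) (×4+-≡ j e))
  where
  shift : ∀ j e → 4 ℕ.* suc j ℕ.+ e ≡ suc (suc (suc (suc (4 ℕ.* j ℕ.+ e))))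
  shift = ℕ-Solver.solve-∀

H : ℤ → ℤ → ℤ → ℤ → ℤ → ℤ → ℤ
H p q a b c d = (p * a - b) * (q * c - d) + (c - p * d) * (a - b * q)

[1-pq]^2[1+j] : ∀ p q j → (+ 1 - p * q) ^ (2 ℕ.* suc j) ≡ (+ 1 - p * q) * ((+ 1 - p * q) * (+ 1 - p * q) ^ (2 ℕ.* j))
[1-pq]^2[1+j] p q j = cong ((+ 1 - p * q) ^_) (ℕₚ.*-suc 2 j)

H-step : ∀ p q a b c d n X →
  Φ p q q (+ 1) c d (suc (suc n)) ≡ (q * c - + 1 * d) * X → Φ p q a b (+ 1) q (suc (suc n)) ≡ (a * + 1 - b * q) * X →
  Φ p q a b c d (suc (suc (suc (suc n)))) ≡ H p q a b c d * X
H-step p q a b c d n X Φ₁ Φ₂ = begin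
  Φ p q a b c d (suc (suc (suc (suc n))))
    ≡⟨ Φ-recurrence p q a b c d n ⟩
  (p * a - b) * Φ p q q (+ 1) c d (suc (suc n)) + (c - p * d) * Φ p q a b (+ 1) q (suc (suc n))
    ≡⟨ cong₂ (λ u v → (p * a - b) * u + (c - p * d) * v) Φ₁ Φ₂ ⟩
  (p * a - b) * ((q * c - + 1 * d) * X) + (c - p * d) * ((a * + 1 - b * q) * X)
    ≡⟨ identity p q a b c d X ⟩
  H p q a b c d * X ∎
  where
  open ≡-Reasoning
  identity : ∀ p q a b c d X → (p * a - b) * ((q * c - + 1 * d) * X) + (c - p * d) * ((a * + 1 - b * q) * X)
    ≡ ((p * a - b) * (q * c - d) + (c - p * d) * (a - b * q)) * X
  identity = ℤ-Solver.solve-∀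

base-step : ∀ p q a b c d n j → let X = (+ 1 - p * q) ^ (2 ℕ.* j) in
  Φ p q q (+ 1) c d (suc (suc n)) ≡ H p q q (+ 1) c d * X → Φ p q a b (+ 1) q (suc (suc n)) ≡ H p q a b (+ 1) q * X →
  Φ p q a b c d (suc (suc (suc (suc n)))) ≡ (a * c - b * d) * (+ 1 - p * q) ^ (2 ℕ.* suc j)
base-step p q a b c d n j Φ₁ Φ₂ = begin
  Φ p q a b c d (suc (suc (suc (suc n))))
    ≡⟨ Φ-recurrence p q a b c d n ⟩
  (p * a - b) * Φ p q q (+ 1) c d (suc (suc n)) + (c - p * d) * Φ p q a b (+ 1) q (suc (suc n))
    ≡⟨ cong₂ (λ u v → (p * a - b) * u + (c - p * d) * v) Φ₁ Φ₂ ⟩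
  (p * a - b) * (H p q q (+ 1) c d * X) + (c - p * d) * (H p q a b (+ 1) q * X)
    ≡⟨ identity p q a b c d X ⟩
  (a * c - b * d) * ((+ 1 - p * q) * ((+ 1 - p * q) * X))
    ≡⟨ cong ((a * c - b * d) *_) ([1-pq]^2[1+j] p q j) ⟨
  (a * c - b * d) * (+ 1 - p * q) ^ (2 ℕ.* suc j) ∎
  where
  open ≡-Reasoning
  X = (+ 1 - p * q) ^ (2 ℕ.* j)
  identity : ∀ p q a b c d X →
    (p * a - b) * (((p * q - + 1) * (q * c - d) + (c - p * d) * (q - + 1 * q)) * X)
      + (c - p * d) * (((p * a - b) * (q * + 1 - q) + (+ 1 - p * q) * (a - b * q)) * X)
    ≡ (a * c - b * d) * ((+ 1 - p * q) * ((+ 1 - p * q) * X))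
  identity = ℤ-Solver.solve-∀

module Period4 (e : ℕ) (Φ-base : ∀ p q a b c d → Φ p q a b c d (suc (suc e)) ≡ a * c - b * d) where

  mutual
    Φ-≡-base : ∀ j p q a b c d →
      Φ p q a b c d (j ×4+ suc (suc e)) ≡ (a * c - b * d) * (+ 1 - p * q) ^ (2 ℕ.* j)
    Φ-≡-base zero p q a b c d = trans (Φ-base p q a b c d) (sym (ℤₚ.*-identityʳ _))
    Φ-≡-base (suc j) p q a b c d = base-step p q a b c d (j ×4+ suc (suc e)) j
      (Φ-≡-H j p q q (+ 1) c d) (Φ-≡-H j p q a b (+ 1) q)

    Φ-≡-H : ∀ j p q a b c d →
      Φ p q a b c d (suc (suc (j ×4+ suc (suc e)))) ≡ H p q a b c d * (+ 1 - p * q) ^ (2 ℕ.* j)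
    Φ-≡-H zero p q a b c d = H-step p q a b c d e (+ 1)
      (Φ-≡-base zero p q q (+ 1) c d) (Φ-≡-base zero p q a b (+ 1) q)
    Φ-≡-H (suc j) p q a b c d = H-step p q a b c d (suc (suc (j ×4+ suc (suc e)))) _
      (Φ-≡-base (suc j) p q q (+ 1) c d) (Φ-≡-base (suc j) p q a b (+ 1) q)

  SgnAltrun-4k+2+e : ∀ k p q → SgnAltrun (4 ℕ.* k ℕ.+ suc (suc e)) p q ≡ + 0
  SgnAltrun-4k+2+e k p q = begin
    SgnAltrun (4 ℕ.* k ℕ.+ suc (suc e)) p q     ≡⟨ cong (λ n → SgnAltrun n p q) (×4+-≡ k (suc (suc e))) ⟩
    SgnAltrun (k ×4+ suc (suc e)) p q           ≡⟨ SgnAltrun≡Φ (k ×4+ suc (suc e)) p q ⟩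
    Φ p q (+ 1) (+ 1) (+ 1) (+ 1) (k ×4+ suc (suc e)) ≡⟨ Φ-≡-base k p q (+ 1) (+ 1) (+ 1) (+ 1) ⟩
    (+ 1 * + 1 - + 1 * + 1) * (+ 1 - p * q) ^ (2 ℕ.* k) ≡⟨ ℤₚ.*-zeroˡ ((+ 1 - p * q) ^ (2 ℕ.* k)) ⟩
    + 0 ∎
    where open ≡-Reasoning

  SgnAltrun-4k+e : ∀ k → 1 ≤ k → ∀ p q →
    SgnAltrun (4 ℕ.* k ℕ.+ e) p q ≡ + 2 * (+ 1 - p) * (+ 1 - q) * (+ 1 - p * q) ^ (2 ℕ.* (k ∸ 1))
  SgnAltrun-4k+e (suc j) _ p q = begin
    SgnAltrun (4 ℕ.* suc j ℕ.+ e) p q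
      ≡⟨ cong (λ n → SgnAltrun n p q) (trans (shift j e) (cong (suc ∘ suc) (×4+-≡ j (suc (suc e))))) ⟩
    SgnAltrun (suc (suc (j ×4+ suc (suc e)))) p q
      ≡⟨ SgnAltrun≡Φ (suc (suc (j ×4+ suc (suc e)))) p q ⟩
    Φ p q (+ 1) (+ 1) (+ 1) (+ 1) (suc (suc (j ×4+ suc (suc e))))
      ≡⟨ Φ-≡-H j p q (+ 1) (+ 1) (+ 1) (+ 1) ⟩
    H p q (+ 1) (+ 1) (+ 1) (+ 1) * (+ 1 - p * q) ^ (2 ℕ.* j)
      ≡⟨ H-1111 p q ((+ 1 - p * q) ^ (2 ℕ.* j)) ⟩
    + 2 * (+ 1 - p) * (+ 1 - q) * (+ 1 - p * q) ^ (2 ℕ.* j) ∎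
    where
    open ≡-Reasoning
    shift : ∀ j e → 4 ℕ.* suc j ℕ.+ e ≡ suc (suc (4 ℕ.* j ℕ.+ suc (suc e)))
    shift = ℕ-Solver.solve-∀
    H-1111 : ∀ p q X → ((p * + 1 - + 1) * (q * + 1 - + 1) + (+ 1 - p * + 1) * (+ 1 - + 1 * q)) * X
      ≡ + 2 * (+ 1 - p) * (+ 1 - q) * X
    H-1111 = ℤ-Solver.solve-∀

theorem1 : (k : ℕ) → 1 ≤ k → (p q : ℤ) →
    (SgnAltrun (4 Data.Nat.* k) p q ≡ + 2 * (+ 1 - p) * (+ 1 - q) * ((+ 1 - p * q) ^ (2 Data.Nat.* (k ∸ 1))))
    × (SgnAltrun (4 Data.Nat.* k Data.Nat.+ 1) p q ≡ + 2 * (+ 1 - p) * (+ 1 - q) * ((+ 1 - p * q) ^ (2 Data.Nat.* (k ∸ 1))))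
    × (SgnAltrun (4 Data.Nat.* k Data.Nat.+ 2) p q ≡ + 0)
    × (SgnAltrun (4 Data.Nat.* k Data.Nat.+ 3) p q ≡ + 0)
theorem1 k 1≤k p q =
  trans (cong (λ n → SgnAltrun n p q) (sym (ℕₚ.+-identityʳ (4 ℕ.* k)))) (Even.SgnAltrun-4k+e k 1≤k p q) ,
  Odd.SgnAltrun-4k+e k 1≤k p q ,
  Even.SgnAltrun-4k+2+e k p q ,
  Odd.SgnAltrun-4k+2+e k p q
  where
  module Even = Period4 0 Φ-2
  module Odd = Period4 1 Φ-3
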